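{- Let $l$ and $n$ be positive integers and let $G$ be a graph on $n$ vertices with $G\not\cong K_{2l+3}\cup M_{n-2l-3}$ and $$e(G)\geq{2l+3 \choose 2}+\Big\lfloor \frac{n-2l-3}{2}\Big\rfloor.$$ If $G$ contains a cycle $C_{2l+2}$ or a cycle $C_{2l+3}$ as a subgraph, then $G$ contains $P_{2l+1}\cup P_3$ as a subgraph.
   Context: All graphs are finite and simple; $e(G)$ is the number of edges. $P_k$ is the path and $C_k$ the cycle on $k$ vertices, $K_k$ the complete graph; $\cup$ is vertex-disjoint union. $M_k$ is the graph on $k$ vertices consisting of $\lfloor k/2\rfloor$ disjoint edges (plus an isolated vertex if $k$ is odd). -}

module Defs where

open import Data.Nat using (ℕ; zero; suc; _+_; _∸_; _<_; _≤_; _<ᵇ_)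
open import Data.Nat.DivMod using (_/_)
open import Data.Bool using (Bool; true; false; _∧_; if_then_else_)
open import Data.Fin using (Fin; toℕ; splitAt)
open import Data.Sum using (_⊎_; inj₁; inj₂)
open import Data.Product using (Σ; _×_)
open import Data.Empty using (⊥)
open import Relation.Nullary using (¬_)
open import Relation.Binary.PropositionalEquality using (_≡_)
open import Function.Definitions using (Injective)
open import Function.Bundles using (_⤖_; _⇔_; Bijection)

record Graph (n : ℕ) : Set where
  field
    adj    : Fin n → Fin n → Bool
    sym    : ∀ i j → adj i j ≡ adj j i
    irrefl : ∀ i → adj i i ≡ false
open Graph public

sumFin : (n : ℕ) → (Fin n → ℕ) → ℕ
sumFin zero    f = 0
sumFin (suc n) f = f Fin.zero + sumFin n (λ i → f (Fin.suc i))

e : ∀ {n} → Graph n → ℕ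
e {n} G = sumFin n (λ i → sumFin n (λ j →
  if (toℕ i <ᵇ toℕ j) ∧ adj G i j then 1 else 0))

PathRel : (k : ℕ) → Fin k → Fin k → Set
PathRel k i j = (suc (toℕ i) ≡ toℕ j) ⊎ (suc (toℕ j) ≡ toℕ i)

-- Cycle C_k on Fin k (meant for k ≥ 3): path edges plus {0, k-1}.
CycleRel : (k : ℕ) → Fin k → Fin k → Set
CycleRel k i j = PathRel k i j
  ⊎ ((toℕ i ≡ 0 × suc (toℕ j) ≡ k) ⊎ (toℕ j ≡ 0 × suc (toℕ i) ≡ k))

DisjUnion : ∀ {a b} → (Fin a → Fin a → Set) → (Fin b → Fin b → Set)
          → Fin (a + b) → Fin (a + b) → Set
DisjUnion {a} R S i j with splitAt a i | splitAt a j
... | inj₁ x | inj₁ y = R x y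
... | inj₂ x | inj₂ y = S x y
... | inj₁ _ | inj₂ _ = ⊥
... | inj₂ _ | inj₁ _ = ⊥

-- K_k ∪ M_{n-k} on Fin n: vertices 0..k-1 form a clique; the remaining
-- vertices k, k+1, ... are matched in consecutive pairs (k,k+1),(k+2,k+3),…,
-- with a leftover isolated vertex if n - k is odd.
KMRel : (k n : ℕ) → Fin n → Fin n → Set
KMRel k n i j = ¬ (i ≡ j) ×
  ((toℕ i < k × toℕ j < k)
   ⊎ (k ≤ toℕ i × k ≤ toℕ j × (toℕ i ∸ k) / 2 ≡ (toℕ j ∸ k) / 2))

Contains : ∀ {n m} → Graph n → (Fin m → Fin m → Set) → Set
Contains {n} {m} G R = Σ (Fin m → Fin n) λ f →
  Injective _≡_ _≡_ f × (∀ i j → R i j → adj G (f i) (f j) ≡ true)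

Iso : ∀ {n} → Graph n → (Fin n → Fin n → Set) → Set
Iso {n} G R = Σ (Fin n ⤖ Fin n) λ φ →
  ∀ i j → (adj G i j ≡ true) ⇔ R (Bijection.to φ i) (Bijection.to φ j)

-- Let C be the given cycle on K ∈ {2l + 2, 2l + 3} vertices and U the u = n − K remaining vertices.
-- Counting degrees, 2e(G) = 2e(G[C]) + 2e(C, U) + 2e(G[U]) with 2e(G[C]) ≤ K(K − 1).
-- A vertex of U with two neighbours in U gives a P₃ beside the path C minus a vertex; so does a cycle
-- vertex with two neighbours in U (for K = 2l + 2), or any cycle vertex with a neighbour in U (for
-- K = 2l + 3, hanging the path off it).  For K = 2l + 2, neighbours x, y in U of consecutive cycle
-- vertices give the configuration too when x ≠ y, and close a C_{2l+3} when x = y.  Otherwise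
-- e(G[U]) ≤ u/2 and e(C, U) ≤ K/2 (resp. = 0), which contradicts the edge bound for K = 2l + 2, and
-- for K = 2l + 3 forces G[C] complete and G[U] a matching missing at most one vertex, i.e.
-- G ≅ K_{2l+3} ∪ M_{n−2l−3}.

module Submission where

open import Defs renaming (sym to adj-sym; irrefl to adj-irrefl)
open import Data.Nat using (ℕ; zero; suc; _+_; _*_; _∸_; _≤_; _<_; _<?_; _≤?_; _≟_; z≤n; s≤s; z<s; _<ᵇ_)
open import Data.Nat.Properties
open import Data.Nat.DivMod using (_/_; _%_; m%n<n; m≡m%n+[m/n]*n; [m+n]%n≡m%n; m<n⇒m%n≡m; %-distribˡ-+; n%n≡0; +-distrib-/; m<n⇒m/n≡0; m*n/n≡m; m*n%n≡0; m<n*o⇒m/o<n; /-monoˡ-≤; m/n*n≤m)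
open import Data.Nat.Combinatorics using (_C_; nCk+nC[k+1]≡[n+1]C[k+1]; nC1≡n)
open import Data.Nat.Tactic.RingSolver using (solve-∀)
open import Data.Bool using (Bool; true; false; _∧_; if_then_else_)
open import Data.Bool.Properties using () renaming (_≟_ to _≟ᵇ_)
open import Data.Fin using (Fin; toℕ; fromℕ<; inject₁; splitAt; _↑ˡ_; _↑ʳ_) renaming (zero to fz; suc to fs)
open import Data.Fin.Properties using (toℕ-injective; toℕ<n; toℕ-fromℕ<; toℕ-inject₁; splitAt⁻¹-↑ˡ; splitAt⁻¹-↑ʳ; all?; any?; ¬∀⟶∃¬) renaming (_≟_ to _≟ᶠ_; suc-injective to fs-injective)
open import Data.Fin.Permutation using (Permutation′; _⟨$⟩ʳ_; _⟨$⟩ˡ_; inverseʳ; inverseˡ; transpose; _∘ₚ_; id; flip)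
import Data.Fin.Permutation.Components as PC
open import Data.Sum using (_⊎_; inj₁; inj₂; [_,_])
open import Data.Product using (Σ; _×_; _,_; proj₁; proj₂)
open import Data.Empty using (⊥; ⊥-elim)
open import Function using (_∘_)
open import Function.Bundles using (_⇔_; mk⇔; Equivalence)
open import Function.Properties.Inverse using (↔⇒⤖)
open import Relation.Nullary using (¬_; Dec; yes; no; does; ofʸ; ofⁿ)
open import Relation.Nullary.Decidable using (dec-true; dec-false)
open import Relation.Binary.PropositionalEquality using (_≡_; refl; sym; trans; cong; cong₂; subst; subst₂; module ≡-Reasoning)
open import Algebra.Properties.Semiring.Sum +-*-semiring
  using (sum; sum-syntax; sum-cong-≗; ∑-distrib-+; ∑-comm; *-distribˡ-sum; *-distribʳ-sum)

sumFin≡sum : ∀ n (f : Fin n → ℕ) → sumFin n f ≡ sum f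
sumFin≡sum zero    f = refl
sumFin≡sum (suc n) f = cong (f fz +_) (sumFin≡sum n (f ∘ fs))

sum-const : ∀ n c → ∑[ i < n ] c ≡ n * c
sum-const zero    c = refl
sum-const (suc n) c = cong (c +_) (sum-const n c)

sum-0 : ∀ n → ∑[ i < n ] 0 ≡ 0
sum-0 n = trans (sum-const n 0) (*-zeroʳ n)

sum-1 : ∀ n → ∑[ i < n ] 1 ≡ n
sum-1 n = trans (sum-const n 1) (*-identityʳ n)

sum-mono-≤ : ∀ {n} {f g : Fin n → ℕ} → (∀ i → f i ≤ g i) → sum f ≤ sum g
sum-mono-≤ {zero}  f≤g = z≤n
sum-mono-≤ {suc n} f≤g = +-mono-≤ (f≤g fz) (sum-mono-≤ (f≤g ∘ fs))

sum-<-pointwise : ∀ {n} {f g : Fin n → ℕ} → (∀ i → f i ≤ g i) → ∀ i → f i < g i → sum f < sum g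
sum-<-pointwise {suc n} f≤g fz     lt = +-mono-<-≤ lt (sum-mono-≤ (f≤g ∘ fs))
sum-<-pointwise {suc n} f≤g (fs i) lt = +-mono-≤-< (f≤g fz) (sum-<-pointwise (f≤g ∘ fs) i lt)

sum≡0⇒≡0 : ∀ {n} (f : Fin n → ℕ) → sum f ≡ 0 → ∀ i → f i ≡ 0
sum≡0⇒≡0 f eq fz     = m+n≡0⇒m≡0 (f fz) eq
sum≡0⇒≡0 f eq (fs i) = sum≡0⇒≡0 (f ∘ fs) (m+n≡0⇒n≡0 (f fz) eq) i

sum-pos⇒∃ : ∀ {n} (f : Fin n → ℕ) → 0 < sum f → Σ (Fin n) λ i → 0 < f i
sum-pos⇒∃ {zero} f ()
sum-pos⇒∃ {suc n} f pos with f fz in eq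
... | suc _ = fz , subst (0 <_) (sym eq) (s≤s z≤n)
... | zero with sum-pos⇒∃ (f ∘ fs) pos
...   | i , p = fs i , p

sum-≤-pointwise-≡ : ∀ {n} {f g : Fin n → ℕ} → (∀ i → f i ≤ g i) → sum g ≤ sum f → ∀ i → f i ≡ g i
sum-≤-pointwise-≡ f≤g Σg≤Σf i =
  ≤-antisym (f≤g i) (≮⇒≥ λ lt → <⇒≱ (sum-<-pointwise f≤g i lt) Σg≤Σf)

sum-<-pointwise₂ : ∀ {n} {f g : Fin n → ℕ} → (∀ i → f i ≤ g i) →
  ∀ {i j} → ¬ i ≡ j → f i < g i → f j < g j → 2 + sum f ≤ sum g
sum-<-pointwise₂ {suc n} {f} {g} f≤g {fz} {fz} i≢j _ _ = ⊥-elim (i≢j refl)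
sum-<-pointwise₂ {suc n} {f} {g} f≤g {fz} {fs j} _ lt₁ lt₂ =
  subst (_≤ g fz + sum (g ∘ fs)) (cong suc (+-suc (f fz) (sum (f ∘ fs))))
    (+-mono-≤ lt₁ (sum-<-pointwise (f≤g ∘ fs) j lt₂))
sum-<-pointwise₂ {suc n} {f} {g} f≤g {fs i} {fz} _ lt₁ lt₂ =
  subst (_≤ g fz + sum (g ∘ fs)) (cong suc (+-suc (f fz) (sum (f ∘ fs))))
    (+-mono-≤ lt₂ (sum-<-pointwise (f≤g ∘ fs) i lt₁))
sum-<-pointwise₂ {suc n} {f} {g} f≤g {fs i} {fs j} i≢j lt₁ lt₂ =
  subst (_≤ g fz + sum (g ∘ fs)) (+-suc₂ (f fz) (sum (f ∘ fs)))
    (+-mono-≤ (f≤g fz) (sum-<-pointwise₂ (f≤g ∘ fs) (i≢j ∘ cong fs) lt₁ lt₂))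
  where
  +-suc₂ : ∀ m n → m + suc (suc n) ≡ suc (suc (m + n))
  +-suc₂ m n = trans (+-suc m (suc n)) (cong suc (+-suc m n))

sum>1⇒two-positive : ∀ {n} (f : Fin n → ℕ) → (∀ i → f i ≤ 1) → 1 < sum f →
  Σ (Fin n) λ i → Σ (Fin n) λ j → ¬ i ≡ j × 0 < f i × 0 < f j
sum>1⇒two-positive {suc n} f f≤1 lt with f fz in eq
... | zero with sum>1⇒two-positive (f ∘ fs) (f≤1 ∘ fs) lt
...   | i , j , i≢j , p , q = fs i , fs j , i≢j ∘ fs-injective , p , q
sum>1⇒two-positive {suc n} f f≤1 lt | suc zero with sum-pos⇒∃ (f ∘ fs) (≤-pred lt)
...   | j , q = fz , fs j , (λ ()) , subst (0 <_) (sym eq) (s≤s z≤n) , q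
sum>1⇒two-positive {suc n} f f≤1 lt | suc (suc _) = ⊥-elim (<⇒≱ (s≤s (s≤s z≤n)) (subst (_≤ 1) eq (f≤1 fz)))

𝟙 : Bool → ℕ
𝟙 b = if b then 1 else 0

𝟙≤1 : ∀ b → 𝟙 b ≤ 1
𝟙≤1 true  = s≤s z≤n
𝟙≤1 false = z≤n

𝟙-pos⇒true : ∀ {b} → 0 < 𝟙 b → b ≡ true
𝟙-pos⇒true {true} _ = refl

δ : ∀ {n} → Fin n → Fin n → ℕ
δ i j = 𝟙 (does (i ≟ᶠ j))

sum-δ* : ∀ {n} (i : Fin n) (g : Fin n → ℕ) → ∑[ j < n ] (δ i j * g j) ≡ g i
sum-δ* {suc n} fz g = trans (cong₂ _+_ (+-identityʳ (g fz)) (sum-0 n)) (+-identityʳ (g fz))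
sum-δ* {suc n} (fs i) g = sum-δ* i (g ∘ fs)

δ-pos⇒≡ : ∀ {n} {i j : Fin n} → 0 < δ i j → i ≡ j
δ-pos⇒≡ {i = i} {j} pos with i ≟ᶠ j
... | yes i≡j = i≡j
... | no _    = ⊥-elim (<-irrefl refl pos)

δ-refl : ∀ {n} (i : Fin n) → δ i i ≡ 1
δ-refl i = cong 𝟙 (dec-true (i ≟ᶠ i) refl)

Fin-∀⇒<-∀ : ∀ {n p} (P : ℕ → Set p) → (∀ (i : Fin n) → P (toℕ i)) → ∀ j → j < n → P j
Fin-∀⇒<-∀ P ∀P j j<n = subst P (toℕ-fromℕ< j<n) (∀P (fromℕ< j<n))

all-or-counterexample : ∀ {n p} {P : Fin n → Set p} → (∀ i → Dec (P i)) → (∀ i → P i) ⊎ Σ (Fin n) λ i → ¬ P i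
all-or-counterexample {n} {P = P} P? with all? P?
... | yes ∀P  = inj₁ ∀P
... | no  ¬∀P = inj₂ (¬∀⟶∃¬ n P P? ¬∀P)

module _ {n} (G : Graph n) where

  edge : Fin n → Fin n → ℕ
  edge i j = 𝟙 (adj G i j)

  deg : Fin n → ℕ
  deg i = ∑[ j < n ] edge i j

  edge-sym : ∀ i j → edge i j ≡ edge j i
  edge-sym i j = cong 𝟙 (adj-sym G i j)

  ¬Edge⇒edge≡0 : ∀ {i j} → ¬ adj G i j ≡ true → edge i j ≡ 0
  ¬Edge⇒edge≡0 {i} {j} ¬e with adj G i j
  ... | true  = ⊥-elim (¬e refl)
  ... | false = refl

  edge-irrefl : ∀ i → edge i i ≡ 0
  edge-irrefl i = cong 𝟙 (adj-irrefl G i)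

  private
    forward : Fin n → Fin n → ℕ
    forward i j = 𝟙 ((toℕ i <ᵇ toℕ j) ∧ adj G i j)

    edge≡forward+backward : ∀ i j → edge i j ≡ forward i j + forward j i
    edge≡forward+backward i j
      rewrite adj-sym G j i
      with toℕ i <ᵇ toℕ j | <ᵇ-reflects-< (toℕ i) (toℕ j)
         | toℕ j <ᵇ toℕ i | <ᵇ-reflects-< (toℕ j) (toℕ i)
    ... | true  | ofʸ i<j | true  | ofʸ j<i = ⊥-elim (<-asym i<j j<i)
    ... | true  | _       | false | _       = sym (+-identityʳ _)
    ... | false | _       | true  | _       = refl
    ... | false | ofⁿ i≮j | false | ofⁿ j≮i
      rewrite toℕ-injective (≤-antisym (≮⇒≥ j≮i) (≮⇒≥ i≮j)) = edge-irrefl j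

  handshake : e G + e G ≡ ∑[ i < n ] deg i
  handshake = sym (begin
    ∑[ i < n ] ∑[ j < n ] edge i j
      ≡⟨ sum-cong-≗ (λ i → trans (sum-cong-≗ (edge≡forward+backward i)) (∑-distrib-+ (forward i) (λ j → forward j i))) ⟩
    ∑[ i < n ] (∑[ j < n ] forward i j + ∑[ j < n ] forward j i)
      ≡⟨ ∑-distrib-+ (λ i → ∑[ j < n ] forward i j) (λ i → ∑[ j < n ] forward j i) ⟩
    ∑[ i < n ] ∑[ j < n ] forward i j + ∑[ i < n ] ∑[ j < n ] forward j i
      ≡⟨ cong (ΣΣforward +_) (∑-comm (λ i j → forward j i)) ⟩
    ΣΣforward + ΣΣforward
      ≡⟨ cong₂ _+_ e≡ΣΣforward e≡ΣΣforward ⟨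
    e G + e G ∎)
    where
    open ≡-Reasoning
    ΣΣforward = ∑[ i < n ] ∑[ j < n ] forward i j
    e≡ΣΣforward : e G ≡ ΣΣforward
    e≡ΣΣforward = trans (sumFin≡sum n _) (sum-cong-≗ (λ i → sumFin≡sum n (forward i)))

suc-choose-2 : ∀ K → suc K C 2 ≡ K + K C 2
suc-choose-2 K = trans (sym (nCk+nC[k+1]≡[n+1]C[k+1] K 1)) (cong (_+ K C 2) (nC1≡n K))

choose-2-double : ∀ K → K C 2 + K C 2 + K ≡ K * K
choose-2-double zero    = refl
choose-2-double (suc K) = begin
    suc K C 2 + suc K C 2 + suc K  ≡⟨ cong (λ x → x + x + suc K) (suc-choose-2 K) ⟩
    (K + K C 2) + (K + K C 2) + suc K  ≡⟨ regroup K (K C 2) ⟩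
    suc (K + K) + (K C 2 + K C 2 + K)  ≡⟨ cong (suc (K + K) +_) (choose-2-double K) ⟩
    suc (K + K) + K * K            ≡⟨ square K ⟩
    suc K * suc K                  ∎
  where
  open ≡-Reasoning
  regroup : ∀ K c → (K + c) + (K + c) + suc K ≡ suc (K + K) + (c + c + K)
  regroup = solve-∀
  square : ∀ K → suc (K + K) + K * K ≡ suc K * suc K
  square = solve-∀

m+m≤n+n⇒m≤n : ∀ {m n} → m + m ≤ n + n → m ≤ n
m+m≤n+n⇒m≤n le = ≮⇒≥ λ n<m → <⇒≱ (+-mono-< n<m n<m) le

m≤m/2+m/2+1 : ∀ m → m ≤ m / 2 + m / 2 + 1
m≤m/2+m/2+1 m = begin
    m                     ≡⟨ m≡m%n+[m/n]*n m 2 ⟩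
    m % 2 + m / 2 * 2     ≤⟨ +-monoˡ-≤ (m / 2 * 2) (≤-pred (m%n<n m 2)) ⟩
    1 + m / 2 * 2         ≡⟨ reorder (m / 2) ⟩
    m / 2 + m / 2 + 1     ∎
  where
  open ≤-Reasoning
  reorder : ∀ x → 1 + x * 2 ≡ x + x + 1
  reorder = solve-∀

m+m≡m*2 : ∀ m → m + m ≡ m * 2
m+m≡m*2 m = trans (cong (m +_) (sym (+-identityʳ m))) (*-comm 2 m)

[j*2+r]/2≡j : ∀ j {r} → r < 2 → (j * 2 + r) / 2 ≡ j
[j*2+r]/2≡j j {r} r<2 = begin
  (j * 2 + r) / 2      ≡⟨ +-distrib-/ (j * 2) r (subst (_< 2) (sym (cong₂ _+_ (m*n%n≡0 j 2) (m<n⇒m%n≡m r<2))) r<2) ⟩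
  j * 2 / 2 + r / 2    ≡⟨ cong₂ _+_ (m*n/n≡m j 2) (m<n⇒m/n≡0 r<2) ⟩
  j + 0                ≡⟨ +-identityʳ j ⟩
  j                    ∎
  where open ≡-Reasoning

m<i+i⇒m/2<i : ∀ {m i} → m < i + i → m / 2 < i
m<i+i⇒m/2<i {m} {i} m<2i = m<n*o⇒m/o<n (subst (m <_) (m+m≡m*2 i) m<2i)

i+i≤m⇒i≤m/2 : ∀ {m i} → i + i ≤ m → i ≤ m / 2
i+i≤m⇒i≤m/2 {m} {i} 2i≤m = subst (_≤ m / 2) (m*n/n≡m i 2) (/-monoˡ-≤ 2 (subst (_≤ m) (m+m≡m*2 i) 2i≤m))

double : ℕ → ℕ
double zero    = zero
double (suc m) = suc (suc (double m))

double≡m+m : ∀ m → double m ≡ m + m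
double≡m+m zero    = refl
double≡m+m (suc m) = cong suc (trans (cong suc (double≡m+m m)) (sym (+-suc m m)))

sum-consecutive-pairs≤ : ∀ m (a : ℕ → ℕ) → (∀ j → suc j < double m → a j + a (suc j) ≤ 1) →
  ∑[ t < double m ] a (toℕ t) ≤ m
sum-consecutive-pairs≤ zero    a pairs = z≤n
sum-consecutive-pairs≤ (suc m) a pairs = subst (_≤ suc m) (+-assoc (a 0) (a 1) _)
  (+-mono-≤ (pairs 0 (s≤s (s≤s z≤n))) (sum-consecutive-pairs≤ m (λ j → a (suc (suc j))) (λ j lt → pairs (suc (suc j)) (s≤s (s≤s lt)))))

m+n≰1⇒both-pos : ∀ {a b} → a ≤ 1 → b ≤ 1 → ¬ a + b ≤ 1 → 0 < a × 0 < b
m+n≰1⇒both-pos {suc _} {suc _} _ _ _ = s≤s z≤n , s≤s z≤n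
m+n≰1⇒both-pos {zero}  {b}     _ b≤1 ≰ = ⊥-elim (≰ b≤1)
m+n≰1⇒both-pos {suc a} {zero}  a≤1 _ ≰ = ⊥-elim (≰ (subst (_≤ 1) (sym (+-identityʳ (suc a))) a≤1))

K+2[1+i]≡2+K+2i : ∀ K i → K + (suc i + suc i) ≡ suc (suc (K + (i + i)))
K+2[1+i]≡2+K+2i = solve-∀

even-cycle-arithmetic : ∀ {E inner cross off u c₂ K l} →
  E + E ≡ inner + (cross + cross) + off → inner ≤ c₂ + c₂ → cross ≤ suc l → off ≤ u →
  K + c₂ + (u ∸ 1) / 2 ≤ E → K ≤ l + 2
even-cycle-arithmetic {E} {inner} {cross} {off} {u} {c₂} {K} {l} 2E≡ inner≤ cross≤ off≤u lower =
  m+m≤n+n⇒m≤n (+-cancelʳ-≤ (c₂ + c₂ + w + w) _ _ (begin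
    (K + K) + (c₂ + c₂ + w + w)                    ≡⟨ regroup₁ K c₂ w ⟩
    (K + c₂ + w) + (K + c₂ + w)                    ≤⟨ +-mono-≤ lower lower ⟩
    E + E                                          ≡⟨ 2E≡ ⟩
    inner + (cross + cross) + off                  ≤⟨ +-mono-≤ (+-mono-≤ inner≤ (+-mono-≤ cross≤ cross≤)) (≤-trans off≤u u≤2w+2) ⟩
    (c₂ + c₂) + (suc l + suc l) + (w + w + 2)      ≡⟨ regroup₂ c₂ l w ⟩
    (l + 2 + (l + 2)) + (c₂ + c₂ + w + w)          ∎))
  where
  open ≤-Reasoning
  w = (u ∸ 1) / 2
  u≤2w+2 : u ≤ w + w + 2
  u≤2w+2 = begin
    u                    ≤⟨ m≤n+m∸n u 1 ⟩
    1 + (u ∸ 1)          ≤⟨ s≤s (m≤m/2+m/2+1 (u ∸ 1)) ⟩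
    1 + (w + w + 1)      ≡⟨ +-comm 1 (w + w + 1) ⟩
    w + w + 1 + 1        ≡⟨ +-assoc (w + w) 1 1 ⟩
    w + w + 2            ∎
  regroup₁ : ∀ K c w → (K + K) + (c + c + w + w) ≡ (K + c + w) + (K + c + w)
  regroup₁ = solve-∀
  regroup₂ : ∀ c l w → (c + c) + (suc l + suc l) + (w + w + 2) ≡ (l + 2 + (l + 2)) + (c + c + w + w)
  regroup₂ = solve-∀

-- The parity of inner = 2h is what upgrades h ≥ c₂ − ½ to h = c₂.
odd-cycle-arithmetic : ∀ {E inner off u c₂ h} →
  E + E ≡ inner + off → inner ≡ h + h → inner ≤ c₂ + c₂ → off ≤ u →
  c₂ + u / 2 ≤ E → h ≡ c₂ × u ≤ suc off
odd-cycle-arithmetic {E} {inner} {off} {u} {c₂} {h} 2E≡ inner≡2h inner≤ off≤u lower = h≡c₂ , u≤1+off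
  where
  open ≤-Reasoning
  w = u / 2
  h≤c₂ : h ≤ c₂
  h≤c₂ = m+m≤n+n⇒m≤n (subst (_≤ c₂ + c₂) inner≡2h inner≤)
  2c₂+2w≤2h+off : (c₂ + c₂) + (w + w) ≤ h + h + off
  2c₂+2w≤2h+off = begin
    (c₂ + c₂) + (w + w)  ≡⟨ regroup c₂ w ⟩
    (c₂ + w) + (c₂ + w)  ≤⟨ +-mono-≤ lower lower ⟩
    E + E                ≡⟨ 2E≡ ⟩
    inner + off          ≡⟨ cong (_+ off) inner≡2h ⟩
    h + h + off          ∎
    where
    regroup : ∀ c w → (c + c) + (w + w) ≡ (c + w) + (c + w)
    regroup = solve-∀
  2c₂≤2h+1 : c₂ + c₂ ≤ suc (h + h)
  2c₂≤2h+1 = +-cancelʳ-≤ (w + w) _ _ (begin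
    (c₂ + c₂) + (w + w)   ≤⟨ 2c₂+2w≤2h+off ⟩
    h + h + off           ≤⟨ +-monoʳ-≤ (h + h) (≤-trans off≤u (m≤m/2+m/2+1 u)) ⟩
    h + h + (w + w + 1)   ≡⟨ regroup h w ⟩
    suc (h + h) + (w + w) ∎)
    where
    regroup : ∀ h w → h + h + (w + w + 1) ≡ suc (h + h) + (w + w)
    regroup = solve-∀
  h≡c₂ : h ≡ c₂
  h≡c₂ = ≤-antisym h≤c₂ (≮⇒≥ λ h<c₂ → <⇒≱ (subst (_≤ c₂ + c₂) (cong suc (+-suc h h)) (+-mono-≤ h<c₂ h<c₂)) 2c₂≤2h+1)
  u≤1+off : u ≤ suc off
  u≤1+off = begin
    u               ≤⟨ m≤m/2+m/2+1 u ⟩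
    w + w + 1       ≡⟨ +-comm (w + w) 1 ⟩
    suc (w + w)     ≤⟨ s≤s (+-cancelˡ-≤ (c₂ + c₂) _ _ (subst (λ x → (c₂ + c₂) + (w + w) ≤ x + x + off) h≡c₂ 2c₂+2w≤2h+off)) ⟩
    suc off         ∎

-- Paths and cycles

module _ {n} (G : Graph n) where

  Edge : Fin n → Fin n → Set
  Edge i j = adj G i j ≡ true

  Edge-sym : ∀ {i j} → Edge i j → Edge j i
  Edge-sym {i} {j} e = trans (adj-sym G j i) e

  Edge⇒≢ : ∀ {i j} → Edge i j → ¬ i ≡ j
  Edge⇒≢ {i} e refl with trans (sym e) (adj-irrefl G i)
  ... | ()

  record Path (k : ℕ) : Set where
    field
      vertex   : ℕ → Fin n
      distinct : ∀ {i j} → i < k → j < k → vertex i ≡ vertex j → i ≡ j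
      step     : ∀ {i} → suc i < k → Edge (vertex i) (vertex (suc i))

  open Path

  Disjoint : ∀ {k m} → Path k → Path m → Set
  Disjoint {k} {m} P Q = ∀ {i j} → i < k → j < m → ¬ vertex P i ≡ vertex Q j

  Avoids : ∀ {k} → Path k → Fin n → Set
  Avoids {k} P x = ∀ {i} → i < k → ¬ vertex P i ≡ x

  cons : ∀ {k} (y : Fin n) (P : Path k) → Avoids P y → Edge y (vertex P 0) → Path (suc k)
  cons {k} y P y∉P y~P₀ = record { vertex = vertex′ ; distinct = distinct′ ; step = step′ }
    where
    vertex′ : ℕ → Fin n
    vertex′ zero    = y
    vertex′ (suc i) = vertex P i
    distinct′ : ∀ {i j} → i < suc k → j < suc k → vertex′ i ≡ vertex′ j → i ≡ j
    distinct′ {zero}  {zero}  _  _  _ = refl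
    distinct′ {zero}  {suc j} _  j< e = ⊥-elim (y∉P (≤-pred j<) (sym e))
    distinct′ {suc i} {zero}  i< _  e = ⊥-elim (y∉P (≤-pred i<) e)
    distinct′ {suc i} {suc j} i< j< e = cong suc (distinct P (≤-pred i<) (≤-pred j<) e)
    step′ : ∀ {i} → suc i < suc k → Edge (vertex′ i) (vertex′ (suc i))
    step′ {zero}  _  = y~P₀
    step′ {suc i} i< = step P (≤-pred i<)

  cons-Avoids : ∀ {k y} (P : Path k) (P∌y : Avoids P y) (y~P₀ : Edge y (vertex P 0)) {h} →
    Avoids P h → ¬ y ≡ h → Avoids (cons y P P∌y y~P₀) h
  cons-Avoids _ _ _ P∌h y≢h {zero}  _  = y≢h
  cons-Avoids _ _ _ P∌h y≢h {suc i} i< = P∌h (≤-pred i<)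

  P₃ : ∀ {h₀ h₁ h₂} → Edge h₀ h₁ → Edge h₁ h₂ → ¬ h₀ ≡ h₂ → Path 3
  P₃ {h₀} {h₁} {h₂} e₀₁ e₁₂ h₀≢h₂ = record { vertex = vertex′ ; distinct = distinct′ ; step = step′ }
    where
    vertex′ : ℕ → Fin n
    vertex′ 0 = h₀
    vertex′ 1 = h₁
    vertex′ _ = h₂
    distinct′ : ∀ {i j} → i < 3 → j < 3 → vertex′ i ≡ vertex′ j → i ≡ j
    distinct′ {0} {0} _ _ _ = refl
    distinct′ {1} {1} _ _ _ = refl
    distinct′ {2} {2} _ _ _ = refl
    distinct′ {0} {1} _ _ e = ⊥-elim (Edge⇒≢ e₀₁ e)
    distinct′ {1} {0} _ _ e = ⊥-elim (Edge⇒≢ e₀₁ (sym e))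
    distinct′ {1} {2} _ _ e = ⊥-elim (Edge⇒≢ e₁₂ e)
    distinct′ {2} {1} _ _ e = ⊥-elim (Edge⇒≢ e₁₂ (sym e))
    distinct′ {0} {2} _ _ e = ⊥-elim (h₀≢h₂ e)
    distinct′ {2} {0} _ _ e = ⊥-elim (h₀≢h₂ (sym e))
    distinct′ {suc (suc (suc _))} (s≤s (s≤s (s≤s ()))) _ _
    distinct′ {_} {suc (suc (suc _))} _ (s≤s (s≤s (s≤s ()))) _
    step′ : ∀ {i} → suc i < 3 → Edge (vertex′ i) (vertex′ (suc i))
    step′ {0} _ = e₀₁
    step′ {1} _ = e₁₂
    step′ {suc (suc _)} (s≤s (s≤s (s≤s ())))

  P₃-Disjoint : ∀ {k} (P : Path k) {h₀ h₁ h₂} (e₀₁ : Edge h₀ h₁) (e₁₂ : Edge h₁ h₂) (h₀≢h₂ : ¬ h₀ ≡ h₂) →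
    Avoids P h₀ → Avoids P h₁ → Avoids P h₂ → Disjoint P (P₃ e₀₁ e₁₂ h₀≢h₂)
  P₃-Disjoint P _ _ _ P∌h₀ P∌h₁ P∌h₂ {j = 0} i<k _ = P∌h₀ i<k
  P₃-Disjoint P _ _ _ P∌h₀ P∌h₁ P∌h₂ {j = 1} i<k _ = P∌h₁ i<k
  P₃-Disjoint P _ _ _ P∌h₀ P∌h₁ P∌h₂ {j = 2} i<k _ = P∌h₂ i<k
  P₃-Disjoint P _ _ _ _ _ _ {j = suc (suc (suc _))} _ (s≤s (s≤s (s≤s ())))

  path-edge : ∀ {k} (P : Path k) i j → PathRel k i j → Edge (vertex P (toℕ i)) (vertex P (toℕ j))
  path-edge P i j (inj₁ i+1≡j) =
    subst (λ m → Edge (vertex P (toℕ i)) (vertex P m)) i+1≡j (step P (subst (_< _) (sym i+1≡j) (toℕ<n j)))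
  path-edge P i j (inj₂ j+1≡i) = Edge-sym (path-edge P j i (inj₁ j+1≡i))

  disjoint-paths⇒Contains : ∀ {k m} (P : Path k) (Q : Path m) → Disjoint P Q →
                            Contains G (DisjUnion {k} {m} (PathRel k) (PathRel m))
  disjoint-paths⇒Contains {k} {m} P Q P∩Q=∅ = f ∘ splitAt k , (λ {x} {y} → f∘split-injective x y) , f-edge
    where
    f : Fin k ⊎ Fin m → Fin n
    f (inj₁ i) = vertex P (toℕ i)
    f (inj₂ j) = vertex Q (toℕ j)
    f∘split-injective : ∀ x y → f (splitAt k x) ≡ f (splitAt k y) → x ≡ y
    f∘split-injective x y eq with splitAt k x in ex | splitAt k y in ey
    ... | inj₁ i | inj₁ j = trans (sym (splitAt⁻¹-↑ˡ ex))
          (trans (cong (_↑ˡ m) (toℕ-injective (distinct P (toℕ<n i) (toℕ<n j) eq))) (splitAt⁻¹-↑ˡ ey))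
    ... | inj₂ i | inj₂ j = trans (sym (splitAt⁻¹-↑ʳ ex))
          (trans (cong (k ↑ʳ_) (toℕ-injective (distinct Q (toℕ<n i) (toℕ<n j) eq))) (splitAt⁻¹-↑ʳ ey))
    ... | inj₁ i | inj₂ j = ⊥-elim (P∩Q=∅ (toℕ<n i) (toℕ<n j) eq)
    ... | inj₂ i | inj₁ j = ⊥-elim (P∩Q=∅ (toℕ<n j) (toℕ<n i) (sym eq))
    f-edge : ∀ x y → DisjUnion (PathRel k) (PathRel m) x y → Edge (f (splitAt k x)) (f (splitAt k y))
    f-edge x y r with splitAt k x | splitAt k y
    ... | inj₁ i | inj₁ j = path-edge P i j r
    ... | inj₂ i | inj₂ j = path-edge Q i j r

  -- A K-periodic vertex sequence, injective on one period, so that rotations are shifts.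
  record Cycle (K : ℕ) : Set where
    field
      vertex   : ℕ → Fin n
      distinct : ∀ {i j} → i < K → j < K → vertex i ≡ vertex j → i ≡ j
      step     : ∀ i → Edge (vertex i) (vertex (suc i))
      periodic : ∀ i → vertex (i + K) ≡ vertex i

  open Cycle

  module _ {K} (γ : Cycle K) where

    prefix : ∀ {k} → k ≤ K → Path k
    prefix k≤K = record
      { vertex = vertex γ
      ; distinct = λ i<k j<k → distinct γ (≤-trans i<k k≤K) (≤-trans j<k k≤K)
      ; step = λ _ → step γ _ }

    Off : Fin n → Set
    Off x = ∀ m → ¬ vertex γ m ≡ x

  module _ {k} (γ : Cycle (suc k)) where

    periodic-* : ∀ q r → vertex γ (r + q * suc k) ≡ vertex γ r
    periodic-* zero    r = cong (vertex γ) (+-identityʳ r)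
    periodic-* (suc q) r = trans (cong (vertex γ) (move-period r (q * suc k))) (trans (periodic γ _) (periodic-* q r))
      where
      move-period : ∀ r m → r + (suc k + m) ≡ r + m + suc k
      move-period r m = trans (cong (r +_) (+-comm (suc k) m)) (sym (+-assoc r m (suc k)))

    vertex-mod : ∀ m → vertex γ m ≡ vertex γ (m % suc k)
    vertex-mod m = trans (cong (vertex γ) (m≡m%n+[m/n]*n m (suc k))) (periodic-* (m / suc k) (m % suc k))

    rotate₁ : Cycle (suc k)
    rotate₁ = record
      { vertex = λ i → vertex γ (suc i)
      ; distinct = distinct′
      ; step = λ i → step γ (suc i)
      ; periodic = λ i → periodic γ (suc i) }
      where
      last-or-not : ∀ {i} → i < suc k → suc i < suc k ⊎ i ≡ k
      last-or-not i<K with m≤n⇒m<n∨m≡n (≤-pred i<K)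
      ... | inj₁ i<k = inj₁ (s≤s i<k)
      ... | inj₂ i≡k = inj₂ i≡k
      last≢ : ∀ {j} → suc j < suc k → ¬ vertex γ (suc k) ≡ vertex γ (suc j)
      last≢ j+1<K e with distinct γ z<s j+1<K (trans (sym (periodic γ 0)) e)
      ... | ()
      distinct′ : ∀ {i j} → i < suc k → j < suc k → vertex γ (suc i) ≡ vertex γ (suc j) → i ≡ j
      distinct′ i<K j<K e with last-or-not i<K | last-or-not j<K
      ... | inj₁ i+1<K | inj₁ j+1<K = suc-injective (distinct γ i+1<K j+1<K e)
      ... | inj₂ i≡k   | inj₂ j≡k   = trans i≡k (sym j≡k)
      ... | inj₂ refl  | inj₁ j+1<K = ⊥-elim (last≢ j+1<K e)
      ... | inj₁ i+1<K | inj₂ refl  = ⊥-elim (last≢ i+1<K (sym e))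

  rotate : ∀ {k} → ℕ → Cycle (suc k) → Cycle (suc k)
  rotate zero    γ = γ
  rotate (suc s) γ = rotate s (rotate₁ γ)

  rotate-vertex : ∀ {k} s (γ : Cycle (suc k)) i → vertex (rotate s γ) i ≡ vertex γ (i + s)
  rotate-vertex zero    γ i = cong (vertex γ) (sym (+-identityʳ i))
  rotate-vertex (suc s) γ i = trans (rotate-vertex s (rotate₁ γ) i) (cong (vertex γ) (sym (+-suc i s)))

  rotate-Off : ∀ {k} s (γ : Cycle (suc k)) {x} → Off γ x → Off (rotate s γ) x
  rotate-Off s γ x∉γ m e = x∉γ (_ + s) (trans (sym (rotate-vertex s γ m)) e)

  rotate-last : ∀ {k} t (γ : Cycle (suc k)) → vertex (rotate (suc t) γ) k ≡ vertex γ t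
  rotate-last {k} t γ = begin
    vertex (rotate (suc t) γ) k ≡⟨ rotate-vertex (suc t) γ k ⟩
    vertex γ (k + suc t)        ≡⟨ cong (vertex γ) (trans (+-suc k t) (cong suc (+-comm k t))) ⟩
    vertex γ (suc (t + k))      ≡⟨ cong (vertex γ) (sym (+-suc t k)) ⟩
    vertex γ (t + suc k)        ≡⟨ periodic γ t ⟩
    vertex γ t                  ∎
    where open ≡-Reasoning

  Contains-cycle⇒Cycle : ∀ {k} → Contains G (CycleRel (suc (suc k))) → Cycle (suc (suc k))
  Contains-cycle⇒Cycle {k} (f , f-injective , f-edge) = record
    { vertex = f ∘ position ; distinct = distinct′ ; step = step′ ; periodic = periodic′ }
    where
    K = suc (suc k)
    position : ℕ → Fin K
    position m = fromℕ< (m%n<n m K)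
    toℕ-position : ∀ m → toℕ (position m) ≡ m % K
    toℕ-position m = toℕ-fromℕ< (m%n<n m K)
    distinct′ : ∀ {i j} → i < K → j < K → f (position i) ≡ f (position j) → i ≡ j
    distinct′ {i} {j} i<K j<K e = begin
      i                  ≡⟨ m<n⇒m%n≡m i<K ⟨
      i % K              ≡⟨ toℕ-position i ⟨
      toℕ (position i)   ≡⟨ cong toℕ (f-injective e) ⟩
      toℕ (position j)   ≡⟨ toℕ-position j ⟩
      j % K              ≡⟨ m<n⇒m%n≡m j<K ⟩
      j                  ∎
      where open ≡-Reasoning
    step′ : ∀ m → Edge (f (position m)) (f (position (suc m)))
    step′ m with suc (m % K) <? K
    ... | yes m%K+1<K = f-edge _ _ (inj₁ (inj₁ (begin
      suc (toℕ (position m)) ≡⟨ cong suc (toℕ-position m) ⟩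
      suc (m % K)            ≡⟨ m<n⇒m%n≡m m%K+1<K ⟨
      suc (m % K) % K        ≡⟨ %-distribˡ-+ 1 m K ⟨
      suc m % K              ≡⟨ toℕ-position (suc m) ⟨
      toℕ (position (suc m)) ∎)))
      where open ≡-Reasoning
    ... | no m%K+1≮K = f-edge _ _ (inj₂ (inj₂ (wrap , trans (cong suc (toℕ-position m)) m%K+1≡K)))
      where
      m%K+1≡K : suc (m % K) ≡ K
      m%K+1≡K = ≤-antisym (m%n<n m K) (≮⇒≥ m%K+1≮K)
      wrap : toℕ (position (suc m)) ≡ 0
      wrap = begin
        toℕ (position (suc m)) ≡⟨ toℕ-position (suc m) ⟩
        suc m % K              ≡⟨ %-distribˡ-+ 1 m K ⟩
        suc (m % K) % K        ≡⟨ cong (_% K) m%K+1≡K ⟩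
        K % K                  ≡⟨ n%n≡0 K ⟩
        0                      ∎
        where open ≡-Reasoning
    periodic′ : ∀ m → f (position (m + K)) ≡ f (position m)
    periodic′ m = cong f (toℕ-injective (trans (toℕ-position (m + K))
                    (trans ([m+n]%n≡m%n m K) (sym (toℕ-position m)))))

  insert-common-neighbour : ∀ {k} (γ : Cycle (suc k)) {x} → Off γ x →
    Edge x (vertex γ 0) → Edge (vertex γ k) x → Contains G (CycleRel (suc (suc k)))
  insert-common-neighbour {k} γ {x} x∉γ x~γ₀ γₖ~x = f , (λ {i} {j} → f-injective i j) , f-edge
    where
    f : Fin (suc (suc k)) → Fin n
    f fz     = x
    f (fs j) = vertex γ (toℕ j)
    f-injective : ∀ i j → f i ≡ f j → i ≡ j
    f-injective fz     fz     _ = refl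
    f-injective fz     (fs j) e = ⊥-elim (x∉γ (toℕ j) (sym e))
    f-injective (fs i) fz     e = ⊥-elim (x∉γ (toℕ i) e)
    f-injective (fs i) (fs j) e = cong fs (toℕ-injective (distinct γ (toℕ<n i) (toℕ<n j) e))
    forward : ∀ i j → suc (toℕ i) ≡ toℕ j → Edge (f i) (f j)
    forward fz     (fs fz)     _ = x~γ₀
    forward (fs i) (fs j)      e = subst (λ m → Edge (vertex γ (toℕ i)) (vertex γ m)) (suc-injective e) (step γ (toℕ i))
    closing : ∀ i j → toℕ i ≡ 0 → suc (toℕ j) ≡ suc (suc k) → Edge (f i) (f j)
    closing fz (fs j) _ e = Edge-sym (subst (λ m → Edge (vertex γ m) x) (sym (suc-injective (suc-injective e))) γₖ~x)
    f-edge : ∀ i j → CycleRel (suc (suc k)) i j → Edge (f i) (f j)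
    f-edge i j (inj₁ (inj₁ e))        = forward i j e
    f-edge i j (inj₁ (inj₂ e))        = Edge-sym (forward j i e)
    f-edge i j (inj₂ (inj₁ (e₀ , e))) = closing i j e₀ e
    f-edge i j (inj₂ (inj₂ (e₀ , e))) = Edge-sym (closing j i e₀ e)

open Path
open Cycle

Path∪P₃ : ∀ {n} → Graph n → ℕ → Set
Path∪P₃ G k = Contains G (DisjUnion {k} {3} (PathRel k) (PathRel 3))

module _ {n} {G : Graph n} {K} (γ : Cycle G K) where

  prefix-avoids-Off : ∀ {k} (k≤K : k ≤ K) {x} → Off G γ x → Avoids G (prefix G γ k≤K) x
  prefix-avoids-Off _ x∉γ _ = x∉γ _

  prefix-avoids-later : ∀ {k} (k≤K : k ≤ K) {m} → k ≤ m → m < K → Avoids G (prefix G γ k≤K) (vertex γ m)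
  prefix-avoids-later k≤K k≤m m<K i<k e = <-irrefl (distinct γ (<-≤-trans i<k k≤K) m<K e) (<-≤-trans i<k k≤m)

  prefix∪cherry : ∀ {k} (k≤K : k ≤ K) {x v y} → Off G γ x → Off G γ y → ¬ x ≡ y →
    Edge G x v → Edge G v y → Avoids G (prefix G γ k≤K) v → Path∪P₃ G k
  prefix∪cherry k≤K x∉γ y∉γ x≢y x~v v~y P∌v =
    disjoint-paths⇒Contains G P (P₃ G x~v v~y x≢y)
      (P₃-Disjoint G P x~v v~y x≢y (prefix-avoids-Off k≤K x∉γ) P∌v (prefix-avoids-Off k≤K y∉γ))
    where P = prefix G γ k≤K

  -- The path is y γ₀ … γ_{q−1} and the P₃ is γ_q γ_{q+1} z.
  pendant∪prefix : ∀ {q} (q+2≤K : suc (suc q) ≤ K) {y z} → Off G γ y → Edge G y (vertex γ 0) →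
    Avoids G (prefix G γ q+2≤K) z → ¬ z ≡ y → Edge G (vertex γ (suc q)) z → Path∪P₃ G (suc q)
  pendant∪prefix {q} q+2≤K {y} {z} y∉γ y~γ₀ P∌z z≢y γq+1~z =
    disjoint-paths⇒Contains G P′ T disjoint
    where
    q≤K = ≤-trans (n≤1+n q) (≤-trans (n≤1+n (suc q)) q+2≤K)
    P = prefix G γ q≤K
    P∌y = prefix-avoids-Off q≤K y∉γ
    P′ = cons G y P P∌y y~γ₀
    P∌γq = prefix-avoids-later q≤K ≤-refl (≤-trans (n≤1+n _) q+2≤K)
    P∌γq+1 = prefix-avoids-later q≤K (n≤1+n q) q+2≤K
    γq≢z : ¬ vertex γ q ≡ z
    γq≢z = P∌z (n≤1+n (suc q))
    P∌z′ : Avoids G P z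
    P∌z′ i<q = P∌z (≤-trans i<q (≤-trans (n≤1+n q) (n≤1+n (suc q))))
    T = P₃ G (step γ q) γq+1~z γq≢z
    disjoint : Disjoint G P′ T
    disjoint = P₃-Disjoint G P′ (step γ q) γq+1~z γq≢z
      (cons-Avoids G P P∌y y~γ₀ P∌γq (λ e → y∉γ q (sym e)))
      (cons-Avoids G P P∌y y~γ₀ P∌γq+1 (λ e → y∉γ (suc q) (sym e)))
      (cons-Avoids G P P∌y y~γ₀ P∌z′ (λ e → z≢y (sym e)))

-- Recognising K_K ∪ M_{n−K}

transpose-at : ∀ {n} (a b : Fin n) → PC.transpose a b a ≡ b
transpose-at a b rewrite dec-true (a ≟ᶠ a) refl = refl

transpose-away : ∀ {n} (a b x : Fin n) → ¬ x ≡ a → ¬ x ≡ b → PC.transpose a b x ≡ x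
transpose-away a b x x≢a x≢b rewrite dec-false (x ≟ᶠ a) x≢a | dec-false (x ≟ᶠ b) x≢b = refl

permutation-injective : ∀ {n} (π : Permutation′ n) {x y} → π ⟨$⟩ʳ x ≡ π ⟨$⟩ʳ y → x ≡ y
permutation-injective π {x} {y} e = trans (sym (inverseˡ π)) (trans (cong (π ⟨$⟩ˡ_) e) (inverseˡ π))

Placement : ∀ {n} → Permutation′ n → Fin n → Fin n → Set
Placement {n} π a v = Σ (Permutation′ n) λ π′ → π′ ⟨$⟩ʳ a ≡ v × (∀ x → toℕ x < toℕ a → π′ ⟨$⟩ʳ x ≡ π ⟨$⟩ʳ x)

place : ∀ {n} (π : Permutation′ n) (a : Fin n) (v : Fin n) → (∀ x → toℕ x < toℕ a → ¬ π ⟨$⟩ʳ x ≡ v) →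
  Placement π a v
place π a v v-unplaced = transpose a b ∘ₚ π , trans (cong (π ⟨$⟩ʳ_) (transpose-at a b)) (inverseʳ π) , below
  where
  b = π ⟨$⟩ˡ v
  below : ∀ x → toℕ x < toℕ a → π ⟨$⟩ʳ PC.transpose a b x ≡ π ⟨$⟩ʳ x
  below x x<a = cong (π ⟨$⟩ʳ_) (transpose-away a b x (λ { refl → <-irrefl refl x<a })
                  (λ x≡b → v-unplaced x x<a (trans (cong (π ⟨$⟩ʳ_) x≡b) (inverseʳ π))))

module _ {K n : ℕ} where

  KM-sym : ∀ {x y : Fin n} → KMRel K n x y → KMRel K n y x
  KM-sym (x≢y , inj₁ (x<K , y<K))           = x≢y ∘ sym , inj₁ (y<K , x<K)
  KM-sym (x≢y , inj₂ (K≤x , K≤y , same-block)) = x≢y ∘ sym , inj₂ (K≤y , K≤x , sym same-block)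

  KM-cross : ∀ i {x y : Fin n} → toℕ x < K + (i + i) → K + (i + i) ≤ toℕ y → ¬ KMRel K n x y
  KM-cross i x< ≤y (_ , inj₁ (_ , y<K)) = <⇒≱ y<K (≤-trans (m≤m+n K (i + i)) ≤y)
  KM-cross i {x} {y} x< ≤y (_ , inj₂ (K≤x , K≤y , same-block)) =
    <⇒≱ (m<i+i⇒m/2<i {i = i} x∸K<2i) (subst (i ≤_) (sym same-block) (i+i≤m⇒i≤m/2 2i≤y∸K))
    where
    x∸K<2i : toℕ x ∸ K < i + i
    x∸K<2i = subst (toℕ x ∸ K <_) (m+n∸m≡n K (i + i)) (∸-monoˡ-< x< K≤x)
    2i≤y∸K : i + i ≤ toℕ y ∸ K
    2i≤y∸K = subst (_≤ toℕ y ∸ K) (m+n∸m≡n K (i + i)) (∸-monoˡ-≤ K ≤y)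

  -- Positions K + 2j and K + 2j + 1 form block j; the partner offset flips the parity bit.
  private
    partner : ℕ → ℕ
    partner d = d / 2 * 2 + (1 ∸ d % 2)

    1∸r<2 : ∀ r → 1 ∸ r < 2
    1∸r<2 r = s≤s (m∸n≤m 1 r)

    partner/2 : ∀ d → partner d / 2 ≡ d / 2
    partner/2 d = [j*2+r]/2≡j (d / 2) (1∸r<2 (d % 2))

    partner≢ : ∀ d → ¬ partner d ≡ d
    partner≢ d eq = flip-≢ (d % 2) (m%n<n d 2) (+-cancelˡ-≡ (d / 2 * 2) _ _ (trans eq d≡))
      where
      d≡ : d ≡ d / 2 * 2 + d % 2
      d≡ = trans (m≡m%n+[m/n]*n d 2) (+-comm (d % 2) _)
      flip-≢ : ∀ r → r < 2 → ¬ 1 ∸ r ≡ r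
      flip-≢ 0 _ ()
      flip-≢ 1 _ ()
      flip-≢ (suc (suc _)) (s≤s (s≤s ()))

    partner< : ∀ {d i} → d < i + i → partner d < i + i
    partner< {d} {i} d<2i = begin-strict
      d / 2 * 2 + (1 ∸ d % 2) <⟨ +-monoʳ-< (d / 2 * 2) (1∸r<2 (d % 2)) ⟩
      d / 2 * 2 + 2           ≡⟨ +-comm (d / 2 * 2) 2 ⟩
      suc (d / 2) * 2         ≤⟨ *-monoˡ-≤ 2 (m<i+i⇒m/2<i {i = i} d<2i) ⟩
      i * 2                   ≡⟨ m+m≡m*2 i ⟨
      i + i                   ∎
      where open ≤-Reasoning

  KM-mate : ∀ i (x : Fin n) → K + (i + i) ≤ n → K ≤ toℕ x → toℕ x < K + (i + i) →
            Σ (Fin n) λ x′ → toℕ x′ < K + (i + i) × KMRel K n x x′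
  KM-mate i x K+2i≤n K≤x x<K+2i = x′ , x′<K+2i , x≢x′ , inj₂ (K≤x , K≤x′ , same-block)
    where
    d = toℕ x ∸ K
    d<2i : d < i + i
    d<2i = subst (d <_) (m+n∸m≡n K (i + i)) (∸-monoˡ-< x<K+2i K≤x)
    K+partner<K+2i : K + partner d < K + (i + i)
    K+partner<K+2i = +-monoʳ-< K (partner< {i = i} d<2i)
    x′ : Fin n
    x′ = fromℕ< (<-≤-trans K+partner<K+2i K+2i≤n)
    toℕ-x′ : toℕ x′ ≡ K + partner d
    toℕ-x′ = toℕ-fromℕ< (<-≤-trans K+partner<K+2i K+2i≤n)
    x′<K+2i : toℕ x′ < K + (i + i)
    x′<K+2i = subst (_< K + (i + i)) (sym toℕ-x′) K+partner<K+2i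
    K≤x′ : K ≤ toℕ x′
    K≤x′ = subst (K ≤_) (sym toℕ-x′) (m≤m+n K (partner d))
    x′∸K≡partner : toℕ x′ ∸ K ≡ partner d
    x′∸K≡partner = trans (cong (_∸ K) toℕ-x′) (m+n∸m≡n K (partner d))
    x≢x′ : ¬ x ≡ x′
    x≢x′ x≡x′ = partner≢ d (sym (trans (cong (_∸ K) (cong toℕ x≡x′)) x′∸K≡partner))
    same-block : d / 2 ≡ (toℕ x′ ∸ K) / 2
    same-block = sym (trans (cong (_/ 2) x′∸K≡partner) (partner/2 d))

Inside : ∀ {n} → ℕ → (ℕ → Fin n) → Fin n → Set
Inside K S v = Σ ℕ λ t → t < K × S t ≡ v

module K∪M-recognition {n} (G : Graph n) (K : ℕ) (S : ℕ → Fin n) (K≤n : K ≤ n)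
  (S-injective : ∀ {t s} → t < K → s < K → S t ≡ S s → t ≡ s)
  (clique : ∀ {t s} → t < K → s < K → ¬ t ≡ s → Edge G (S t) (S s))
  (no-edge-leaving : ∀ {t x} → t < K → ¬ Inside K S x → ¬ Edge G (S t) x)
  (outside-deg≤1 : ∀ {v x y} → ¬ Inside K S v → Edge G v x → Edge G v y → x ≡ y)
  (isolated-unique : ∀ {v w} → ¬ Inside K S v → ¬ Inside K S w →
                     (∀ x → ¬ Edge G v x) → (∀ x → ¬ Edge G w x) → v ≡ w)
  where

  Clique-placed-below : ℕ → Permutation′ n → Set
  Clique-placed-below t π = ∀ x → toℕ x < t → π ⟨$⟩ʳ x ≡ S (toℕ x)

  Clique-placed : Permutation′ n → Set
  Clique-placed = Clique-placed-below K

  Realises : ℕ → Permutation′ n → Set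
  Realises b π = ∀ x y → toℕ x < b → toℕ y < b → KMRel K n x y → Edge G (π ⟨$⟩ʳ x) (π ⟨$⟩ʳ y)

  -- π maps positions to vertices: the clique sits at positions below K and the first i matched
  -- pairs at positions K … K + 2i − 1.
  Placed : ℕ → Set
  Placed i = Σ (Permutation′ n) λ π → Clique-placed π × Realises (K + (i + i)) π

  outside-placed : ∀ {π} → Clique-placed π → ∀ {y} → K ≤ toℕ y → ¬ Inside K S (π ⟨$⟩ʳ y)
  outside-placed {π} placed {y} K≤y (t , t<K , Sₜ≡πy) = <⇒≱ t<K (subst (K ≤_) y≡t K≤y)
    where
    t<n = <-≤-trans t<K K≤n
    x = fromℕ< t<n
    y≡t : toℕ y ≡ t
    y≡t = trans (cong toℕ (sym (permutation-injective π
            (trans (placed x (subst (_< K) (sym (toℕ-fromℕ< t<n)) t<K)) (trans (cong S (toℕ-fromℕ< t<n)) Sₜ≡πy)))))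
            (toℕ-fromℕ< t<n)

  clique-placement : ∀ t → t ≤ K → Σ (Permutation′ n) (Clique-placed-below t)
  clique-placement zero    _   = id , λ _ ()
  clique-placement (suc t) t<K = extend (clique-placement t (≤-trans (n≤1+n t) t<K))
    where
    t<n = <-≤-trans t<K K≤n
    a = fromℕ< t<n
    toℕ-a : toℕ a ≡ t
    toℕ-a = toℕ-fromℕ< t<n
    extend : Σ (Permutation′ n) (Clique-placed-below t) → Σ (Permutation′ n) (Clique-placed-below (suc t))
    extend (π , below-t) = finish (place π a (S t) unplaced)
      where
      unplaced : ∀ x → toℕ x < toℕ a → ¬ π ⟨$⟩ʳ x ≡ S t
      unplaced x x<a e = <-irrefl (S-injective (<-trans x<t t<K) t<K (trans (sym (below-t x x<t)) e)) x<t
        where x<t = subst (toℕ x <_) toℕ-a x<a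
      finish : Placement π a (S t) → Σ (Permutation′ n) (Clique-placed-below (suc t))
      finish (π′ , π′a≡Sₜ , agree) = π′ , below-t+1
        where
        below-t+1 : Clique-placed-below (suc t) π′
        below-t+1 x x<t+1 with m≤n⇒m<n∨m≡n (≤-pred x<t+1)
        ... | inj₁ x<t = trans (agree x (subst (toℕ x <_) (sym toℕ-a) x<t)) (below-t x x<t)
        ... | inj₂ x≡t with toℕ-injective {i = x} {j = a} (trans x≡t (sym toℕ-a))
        ...   | refl = trans π′a≡Sₜ (cong S (sym x≡t))

  placed-0 : Placed 0
  placed-0 = π , placed , realises
    where
    π = proj₁ (clique-placement K ≤-refl)
    placed : Clique-placed π
    placed = proj₂ (clique-placement K ≤-refl)
    realises : Realises (K + 0) π
    realises x y _ _ (x≢y , inj₁ (x<K , y<K)) =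
      subst₂ (Edge G) (sym (placed x x<K)) (sym (placed y y<K)) (clique x<K y<K (x≢y ∘ toℕ-injective))
    realises x y x<K+0 _ (_ , inj₂ (K≤x , _)) = ⊥-elim (<⇒≱ (subst (toℕ x <_) (+-identityʳ K) x<K+0) K≤x)

  module Extend {i} {π} (placed : Clique-placed π) (realises : Realises (K + (i + i)) π)
                (room : suc (suc (K + (i + i))) ≤ n) where
    P = K + (i + i)
    P<n : P < n
    P<n = ≤-trans (n≤1+n _) room
    p₀ = fromℕ< P<n
    p₁ = fromℕ< room
    toℕ-p₀ : toℕ p₀ ≡ P
    toℕ-p₀ = toℕ-fromℕ< P<n
    toℕ-p₁ : toℕ p₁ ≡ suc P
    toℕ-p₁ = toℕ-fromℕ< room

    P≤p₀ : P ≤ toℕ p₀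
    P≤p₀ = ≤-reflexive (sym toℕ-p₀)
    P≤p₁ : P ≤ toℕ p₁
    P≤p₁ = ≤-trans (n≤1+n P) (≤-reflexive (sym toℕ-p₁))

    location : ∀ z → toℕ z < K + (suc i + suc i) → toℕ z < P ⊎ (z ≡ p₀ ⊎ z ≡ p₁)
    location z z< with toℕ z <? P
    ... | yes z<P = inj₁ z<P
    ... | no z≮P with m≤n⇒m<n∨m≡n (≤-pred (subst (toℕ z <_) (K+2[1+i]≡2+K+2i K i) z<))
    ...   | inj₂ z≡P+1 = inj₂ (inj₂ (toℕ-injective (trans z≡P+1 (sym toℕ-p₁))))
    ...   | inj₁ z<P+1 = inj₂ (inj₁ (toℕ-injective (trans (≤-antisym (≤-pred z<P+1) (≮⇒≥ z≮P)) (sym toℕ-p₀))))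
    new-≥P : ∀ {z} → z ≡ p₀ ⊎ z ≡ p₁ → P ≤ toℕ z
    new-≥P (inj₁ refl) = P≤p₀
    new-≥P (inj₂ refl) = P≤p₁

    Unplaced : Permutation′ n → ℕ → Fin n → Set
    Unplaced σ b v = ∀ x → toℕ x < b → ¬ σ ⟨$⟩ʳ x ≡ v

    -- Placed clique vertices have no outside neighbours, and placed outside vertices already have
    -- their unique neighbour placed.
    neighbour-unplaced : ∀ {m p} → ¬ Inside K S m → Unplaced π P m → Edge G m p → Unplaced π P p
    neighbour-unplaced {m} {p} m-out m-unplaced m~p x x<P πx≡p with toℕ x <? K
    ... | yes x<K = no-edge-leaving x<K m-out (subst (λ w → Edge G w m) (trans (sym πx≡p) (placed x x<K)) (Edge-sym G m~p))
    ... | no x≮K with KM-mate i x (≤-trans (n≤1+n _) P<n) (≮⇒≥ x≮K) x<P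
    ...   | x′ , x′<P , x-x′ = m-unplaced x′ x′<P (sym (outside-deg≤1 p-out p~m p~πx′))
      where
      p-out : ¬ Inside K S p
      p-out = subst (¬_ ∘ Inside K S) πx≡p (outside-placed {π} placed {x} (≮⇒≥ x≮K))
      p~m = Edge-sym G m~p
      p~πx′ = subst (λ w → Edge G w (π ⟨$⟩ʳ x′)) πx≡p (realises x x′ x<P x′<P x-x′)

    fresh-outside : ∀ {x} → P ≤ toℕ x → ¬ Inside K S (π ⟨$⟩ʳ x)
    fresh-outside P≤x = outside-placed {π} placed (≤-trans (m≤m+n K (i + i)) P≤x)

    fresh-unplaced : ∀ {y} → P ≤ toℕ y → Unplaced π P (π ⟨$⟩ʳ y)
    fresh-unplaced P≤y x x<P πx≡πy = <⇒≱ x<P (subst (λ z → P ≤ toℕ z) (sym (permutation-injective π πx≡πy)) P≤y)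

    Seed : Set
    Seed = Σ (Fin n) λ m → Σ (Fin n) λ p → ¬ Inside K S m × Unplaced π P m × Edge G m p

    -- Of the two vertices currently at positions P and P + 1, at most one is isolated.
    seed : Seed
    seed with any? (λ x → adj G (π ⟨$⟩ʳ p₀) x ≟ᵇ true)
    ... | yes (p , e) = π ⟨$⟩ʳ p₀ , p , fresh-outside P≤p₀ , fresh-unplaced P≤p₀ , e
    ... | no none₀ with any? (λ x → adj G (π ⟨$⟩ʳ p₁) x ≟ᵇ true)
    ...   | yes (p , e) = π ⟨$⟩ʳ p₁ , p , fresh-outside P≤p₁ , fresh-unplaced P≤p₁ , e
    ...   | no none₁ = ⊥-elim (1+n≢n (sym (trans (sym toℕ-p₀) (trans (cong toℕ p₀≡p₁) toℕ-p₁))))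
      where
      p₀≡p₁ : p₀ ≡ p₁
      p₀≡p₁ = permutation-injective π (isolated-unique (fresh-outside P≤p₀) (fresh-outside P≤p₁)
                (λ x e → none₀ (x , e)) (λ x e → none₁ (x , e)))

    realises-extension : ∀ {σ m p} → (∀ z → toℕ z < P → σ ⟨$⟩ʳ z ≡ π ⟨$⟩ʳ z) → σ ⟨$⟩ʳ p₀ ≡ m → σ ⟨$⟩ʳ p₁ ≡ p →
      Edge G m p → Realises (K + (suc i + suc i)) σ
    realises-extension {σ} agree σp₀≡m σp₁≡p m~p x y x< y< R with location x x< | location y y<
    ... | inj₁ x<P | inj₁ y<P = subst₂ (Edge G) (sym (agree x x<P)) (sym (agree y y<P)) (realises x y x<P y<P R)
    ... | inj₁ x<P | inj₂ y-new = ⊥-elim (KM-cross i x<P (new-≥P y-new) R)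
    ... | inj₂ x-new | inj₁ y<P = ⊥-elim (KM-cross i y<P (new-≥P x-new) (KM-sym R))
    ... | inj₂ (inj₁ refl) | inj₂ (inj₁ refl) = ⊥-elim (proj₁ R refl)
    ... | inj₂ (inj₂ refl) | inj₂ (inj₂ refl) = ⊥-elim (proj₁ R refl)
    ... | inj₂ (inj₁ refl) | inj₂ (inj₂ refl) = subst₂ (Edge G) (sym σp₀≡m) (sym σp₁≡p) m~p
    ... | inj₂ (inj₂ refl) | inj₂ (inj₁ refl) = subst₂ (Edge G) (sym σp₁≡p) (sym σp₀≡m) (Edge-sym G m~p)

    extended : Placed (suc i)
    extended with seed
    ... | m , p , m-out , m-unplaced , m~p = place-both (place π p₀ m (λ x x< → m-unplaced x (subst (toℕ x <_) toℕ-p₀ x<)))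
      where
      p-unplaced = neighbour-unplaced m-out m-unplaced m~p
      place-both : Placement π p₀ m → Placed (suc i)
      place-both (π₁ , π₁p₀≡m , agree₁) = place-second (place π₁ p₁ p p-unplaced₁)
        where
        agree₁′ : ∀ x → toℕ x < P → π₁ ⟨$⟩ʳ x ≡ π ⟨$⟩ʳ x
        agree₁′ x x<P = agree₁ x (subst (toℕ x <_) (sym toℕ-p₀) x<P)
        p-unplaced₁ : ∀ x → toℕ x < toℕ p₁ → ¬ π₁ ⟨$⟩ʳ x ≡ p
        p-unplaced₁ x x<P+1 π₁x≡p with toℕ x <? P
        ... | yes x<P = p-unplaced x x<P (trans (sym (agree₁′ x x<P)) π₁x≡p)
        ... | no x≮P = Edge⇒≢ G m~p (trans (sym π₁p₀≡m) (trans (cong (π₁ ⟨$⟩ʳ_) (sym x≡p₀)) π₁x≡p))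
          where
          x≡p₀ : x ≡ p₀
          x≡p₀ = toℕ-injective (trans (≤-antisym (≤-pred (subst (toℕ x <_) toℕ-p₁ x<P+1)) (≮⇒≥ x≮P)) (sym toℕ-p₀))
        place-second : Placement π₁ p₁ p → Placed (suc i)
        place-second (π₂ , π₂p₁≡p , agree₂) = π₂ , placed₂ , realises-extension {π₂} agree π₂p₀≡m π₂p₁≡p m~p
          where
          agree : ∀ z → toℕ z < P → π₂ ⟨$⟩ʳ z ≡ π ⟨$⟩ʳ z
          agree z z<P = trans (agree₂ z (subst (toℕ z <_) (sym toℕ-p₁) (<-trans z<P (n<1+n P)))) (agree₁′ z z<P)
          π₂p₀≡m : π₂ ⟨$⟩ʳ p₀ ≡ m
          π₂p₀≡m = trans (agree₂ p₀ (subst₂ _<_ (sym toℕ-p₀) (sym toℕ-p₁) (n<1+n P))) π₁p₀≡m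
          placed₂ : Clique-placed π₂
          placed₂ x x<K = trans (agree x (≤-trans x<K (m≤m+n K (i + i)))) (placed x x<K)

  placed-upto : ∀ i → K + (i + i) ≤ n → Placed i
  placed-upto zero    _    = placed-0
  placed-upto (suc i) room with placed-upto i (≤-trans (+-monoʳ-≤ K (+-mono-≤ (n≤1+n i) (n≤1+n i))) room)
  ... | π , placed , realises = Extend.extended {i} {π} placed realises (subst (_≤ n) (K+2[1+i]≡2+K+2i K i) room)

  permutation⇒Iso : (π : Permutation′ n) → (∀ x y → Edge G (π ⟨$⟩ʳ x) (π ⟨$⟩ʳ y) ⇔ KMRel K n x y) → Iso G (KMRel K n)
  permutation⇒Iso π matches = ↔⇒⤖ (flip π) , λ u v → mk⇔
    (λ u~v → Equivalence.to (matches (π ⟨$⟩ˡ u) (π ⟨$⟩ˡ v)) (subst₂ (Edge G) (sym (inverseʳ π)) (sym (inverseʳ π)) u~v))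
    (λ R → subst₂ (Edge G) (inverseʳ π) (inverseʳ π) (Equivalence.from (matches (π ⟨$⟩ˡ u) (π ⟨$⟩ˡ v)) R))

  module Complete {i} {π} (placed : Clique-placed π) (realises : Realises (K + (i + i)) π)
                  (room : K + (i + i) ≤ n) (tight : n ≤ suc (K + (i + i))) where
    P = K + (i + i)

    last-position : ∀ {x : Fin n} → ¬ toℕ x < P → toℕ x ≡ P
    last-position {x} x≮P = ≤-antisym (≤-pred (≤-trans (toℕ<n x) tight)) (≮⇒≥ x≮P)

    KM⇒below : ∀ {x y} → KMRel K n x y → toℕ x < P
    KM⇒below {x} {y} R with toℕ x <? P | toℕ y <? P
    ... | yes x<P | _       = x<P
    ... | no x≮P  | yes y<P = ⊥-elim (KM-cross i y<P (≮⇒≥ x≮P) (KM-sym R))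
    ... | no x≮P  | no y≮P  = ⊥-elim (proj₁ R (toℕ-injective (trans (last-position x≮P) (sym (last-position y≮P)))))

    KM⇒Edge : ∀ x y → KMRel K n x y → Edge G (π ⟨$⟩ʳ x) (π ⟨$⟩ʳ y)
    KM⇒Edge x y R = realises x y (KM⇒below R) (KM⇒below (KM-sym R)) R

    matched-Edge⇒KM : ∀ {x y} → K ≤ toℕ x → toℕ x < P → Edge G (π ⟨$⟩ʳ x) (π ⟨$⟩ʳ y) → KMRel K n x y
    matched-Edge⇒KM {x} {y} K≤x x<P πx~πy with KM-mate i x room K≤x x<P
    ... | x′ , x′<P , R with permutation-injective π (outside-deg≤1 (outside-placed {π} placed K≤x) πx~πy (realises x x′ x<P x′<P R))
    ...   | refl = R

    Edge⇒KM : ∀ x y → Edge G (π ⟨$⟩ʳ x) (π ⟨$⟩ʳ y) → KMRel K n x y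
    Edge⇒KM x y πx~πy with toℕ x <? K | toℕ y <? K
    ... | yes x<K | yes y<K = Edge⇒≢ G πx~πy ∘ cong (π ⟨$⟩ʳ_) , inj₁ (x<K , y<K)
    ... | yes x<K | no y≮K  = ⊥-elim (no-edge-leaving x<K (outside-placed {π} placed (≮⇒≥ y≮K))
                                (subst (λ w → Edge G w (π ⟨$⟩ʳ y)) (placed x x<K) πx~πy))
    ... | no x≮K  | yes y<K = ⊥-elim (no-edge-leaving y<K (outside-placed {π} placed (≮⇒≥ x≮K))
                                (subst (λ w → Edge G w (π ⟨$⟩ʳ x)) (placed y y<K) (Edge-sym G πx~πy)))
    ... | no x≮K  | no y≮K with toℕ x <? P | toℕ y <? P
    ...   | yes x<P | _       = matched-Edge⇒KM (≮⇒≥ x≮K) x<P πx~πy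
    ...   | no _    | yes y<P = KM-sym (matched-Edge⇒KM (≮⇒≥ y≮K) y<P (Edge-sym G πx~πy))
    ...   | no x≮P  | no y≮P  = ⊥-elim (Edge⇒≢ G πx~πy (cong (π ⟨$⟩ʳ_)
                                  (toℕ-injective (trans (last-position x≮P) (sym (last-position y≮P))))))

  isomorphic : Iso G (KMRel K n)
  isomorphic = assemble (placed-upto half room)
    where
    d = n ∸ K
    half = d / 2
    n≡K+d : n ≡ K + d
    n≡K+d = sym (m+[n∸m]≡n K≤n)
    room : K + (half + half) ≤ n
    room = subst (K + (half + half) ≤_) (sym n≡K+d)
             (+-monoʳ-≤ K (subst (_≤ d) (sym (m+m≡m*2 half)) (m/n*n≤m d 2)))
    tight : n ≤ suc (K + (half + half))
    tight = subst₂ _≤_ (sym n≡K+d) (trans (cong (K +_) (+-comm (half + half) 1)) (+-suc K (half + half)))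
              (+-monoʳ-≤ K (m≤m/2+m/2+1 d))
    assemble : Placed half → Iso G (KMRel K n)
    assemble (π , placed , realises) = permutation⇒Iso π λ x y → mk⇔ (Edge⇒KM x y) (KM⇒Edge x y)
      where open Complete {half} {π} placed realises room tight

-- Counting edges around a cycle

module AroundCycle {n} {G : Graph n} {k} (γ : Cycle G (suc k)) where

  K : ℕ
  K = suc k

  c : Fin K → Fin n
  c t = vertex γ (toℕ t)

  multiplicity : Fin n → ℕ
  multiplicity v = ∑[ t < K ] δ (c t) v

  multiplicity≤1 : ∀ v → multiplicity v ≤ 1
  multiplicity≤1 v with 1 <? multiplicity v
  ... | no ≯1 = ≮⇒≥ ≯1
  ... | yes >1 with sum>1⇒two-positive (λ t → δ (c t) v) (λ t → 𝟙≤1 _) >1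
  ...   | t , t′ , t≢t′ , p , p′ = ⊥-elim (t≢t′ (toℕ-injective
            (distinct γ (toℕ<n t) (toℕ<n t′) (trans (δ-pos⇒≡ p) (sym (δ-pos⇒≡ p′))))))

  off : Fin n → ℕ
  off v = 1 ∸ multiplicity v

  multiplicity+off : ∀ v → multiplicity v + off v ≡ 1
  multiplicity+off v = m+[n∸m]≡n (multiplicity≤1 v)

  off≤1 : ∀ v → off v ≤ 1
  off≤1 v = m∸n≤m 1 (multiplicity v)

  off-cases : ∀ v → off v ≡ 0 ⊎ off v ≡ 1
  off-cases v with off v | off≤1 v
  ... | 0 | _ = inj₁ refl
  ... | 1 | _ = inj₂ refl
  ... | suc (suc _) | s≤s ()

  off≡1⇒Off : ∀ {v} → off v ≡ 1 → Off G γ v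
  off≡1⇒Off {v} off≡1 m γₘ≡v = 0≢1+n (trans (sym (sum≡0⇒≡0 (λ t → δ (c t) v) multiplicity≡0 t)) δ≡1)
    where
    multiplicity≡0 : multiplicity v ≡ 0
    multiplicity≡0 = +-cancelʳ-≡ 1 (multiplicity v) 0 (trans (cong (multiplicity v +_) (sym off≡1)) (multiplicity+off v))
    t : Fin K
    t = fromℕ< (m%n<n m K)
    c[t]≡v : c t ≡ v
    c[t]≡v = trans (cong (vertex γ) (toℕ-fromℕ< (m%n<n m K))) (trans (sym (vertex-mod G γ m)) γₘ≡v)
    δ≡1 : δ (c t) v ≡ 1
    δ≡1 = trans (cong (λ w → δ w v) c[t]≡v) (δ-refl v)

  off≡0⇒multiplicity≡1 : ∀ {v} → off v ≡ 0 → multiplicity v ≡ 1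
  off≡0⇒multiplicity≡1 {v} off≡0 =
    trans (sym (+-identityʳ _)) (trans (cong (multiplicity v +_) (sym off≡0)) (multiplicity+off v))

  off≡0⇒on : ∀ {v} → off v ≡ 0 → Σ (Fin K) λ t → c t ≡ v
  off≡0⇒on {v} off≡0 with sum-pos⇒∃ (λ t → δ (c t) v) (≤-reflexive (sym (off≡0⇒multiplicity≡1 off≡0)))
  ... | t , p = t , δ-pos⇒≡ p

  split-sum : ∀ (h : Fin n → ℕ) → ∑[ v < n ] h v ≡ ∑[ t < K ] h (c t) + ∑[ v < n ] (off v * h v)
  split-sum h = begin
    ∑[ v < n ] h v
      ≡⟨ sum-cong-≗ (λ v → trans (cong (_* h v) (multiplicity+off v)) (*-identityˡ (h v))) ⟨
    ∑[ v < n ] ((multiplicity v + off v) * h v)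
      ≡⟨ sum-cong-≗ (λ v → *-distribʳ-+ (h v) (multiplicity v) (off v)) ⟩
    ∑[ v < n ] (multiplicity v * h v + off v * h v)
      ≡⟨ ∑-distrib-+ (λ v → multiplicity v * h v) (λ v → off v * h v) ⟩
    ∑[ v < n ] (multiplicity v * h v) + ∑[ v < n ] (off v * h v)
      ≡⟨ cong (_+ ∑[ v < n ] (off v * h v)) on-cycle ⟩
    ∑[ t < K ] h (c t) + ∑[ v < n ] (off v * h v) ∎
    where
    open ≡-Reasoning
    on-cycle : ∑[ v < n ] (multiplicity v * h v) ≡ ∑[ t < K ] h (c t)
    on-cycle = begin
      ∑[ v < n ] (multiplicity v * h v)    ≡⟨ sum-cong-≗ (λ v → *-distribʳ-sum (h v) (λ t → δ (c t) v)) ⟩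
      ∑[ v < n ] ∑[ t < K ] (δ (c t) v * h v) ≡⟨ ∑-comm (λ v t → δ (c t) v * h v) ⟩
      ∑[ t < K ] ∑[ v < n ] (δ (c t) v * h v) ≡⟨ sum-cong-≗ (λ t → sum-δ* (c t) h) ⟩
      ∑[ t < K ] h (c t)                 ∎

  off-weighted-pos : ∀ {v m} → 0 < off v * m → Off G γ v × 0 < m
  off-weighted-pos {v} {m} pos with off-cases v
  ... | inj₁ off≡0 = ⊥-elim (<-irrefl refl (subst (λ o → 0 < o * m) off≡0 pos))
  ... | inj₂ off≡1 = off≡1⇒Off off≡1 , subst (0 <_) (+-identityʳ m) (subst (λ o → 0 < o * m) off≡1 pos)

  outdeg : Fin n → ℕ
  outdeg v = ∑[ j < n ] (off j * edge G v j)

  outdeg-pos⇒neighbour : ∀ {v} → 0 < outdeg v → Σ (Fin n) λ x → Off G γ x × Edge G v x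
  outdeg-pos⇒neighbour {v} pos with sum-pos⇒∃ (λ j → off j * edge G v j) pos
  ... | x , p with off-weighted-pos p
  ...   | x∉γ , e = x , x∉γ , 𝟙-pos⇒true e

  outdeg>1⇒two-neighbours : ∀ {v} → 1 < outdeg v →
    Σ (Fin n) λ x → Σ (Fin n) λ y → ¬ x ≡ y × (Off G γ x × Edge G v x) × (Off G γ y × Edge G v y)
  outdeg>1⇒two-neighbours {v} >1
    with sum>1⇒two-positive (λ j → off j * edge G v j) (λ j → *-mono-≤ (off≤1 j) (𝟙≤1 _)) >1
  ... | x , y , x≢y , p , q with off-weighted-pos p | off-weighted-pos q
  ...   | x∉γ , ex | y∉γ , ey = x , y , x≢y , (x∉γ , 𝟙-pos⇒true ex) , (y∉γ , 𝟙-pos⇒true ey)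

  -- With U the vertices off the cycle: innerSum = 2e(G[C]), crossSum = e(C, U), offSum = 2e(G[U]),
  -- offCount = |U|.
  row : Fin K → ℕ
  row t = ∑[ s < K ] edge G (c t) (c s)

  innerSum : ℕ
  innerSum = ∑[ t < K ] row t

  crossSum : ℕ
  crossSum = ∑[ t < K ] outdeg (c t)

  offSum : ℕ
  offSum = ∑[ v < n ] (off v * outdeg v)

  offCount : ℕ
  offCount = ∑[ v < n ] off v

  n≡K+offCount : n ≡ K + offCount
  n≡K+offCount = begin
    n                                                   ≡⟨ sum-1 n ⟨
    ∑[ v < n ] 1                                        ≡⟨ split-sum (λ _ → 1) ⟩
    ∑[ t < K ] 1 + ∑[ v < n ] (off v * 1)               ≡⟨ cong₂ _+_ (sum-1 K) (sum-cong-≗ (λ v → *-identityʳ (off v))) ⟩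
    K + offCount                                        ∎
    where open ≡-Reasoning

  deg-split : ∀ v → deg G v ≡ ∑[ s < K ] edge G v (c s) + outdeg v
  deg-split v = split-sum (edge G v)

  decomposition : e G + e G ≡ innerSum + (crossSum + crossSum) + offSum
  decomposition = begin
    e G + e G
      ≡⟨ handshake G ⟩
    ∑[ v < n ] deg G v
      ≡⟨ split-sum (deg G) ⟩
    ∑[ t < K ] deg G (c t) + ∑[ v < n ] (off v * deg G v)
      ≡⟨ cong₂ _+_ on-cycle off-cycle ⟩
    (innerSum + crossSum) + (crossSum + offSum)
      ≡⟨ regroup innerSum crossSum offSum ⟩
    innerSum + (crossSum + crossSum) + offSum ∎
    where
    open ≡-Reasoning
    regroup : ∀ a b d → (a + b) + (b + d) ≡ a + (b + b) + d
    regroup a b d = trans (sym (+-assoc (a + b) b d)) (cong (_+ d) (+-assoc a b b))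
    on-cycle : ∑[ t < K ] deg G (c t) ≡ innerSum + crossSum
    on-cycle = trans (sum-cong-≗ (deg-split ∘ c)) (∑-distrib-+ row (outdeg ∘ c))
    edges-to-cycle : ∑[ v < n ] (off v * ∑[ s < K ] edge G v (c s)) ≡ crossSum
    edges-to-cycle = begin
      ∑[ v < n ] (off v * ∑[ s < K ] edge G v (c s))  ≡⟨ sum-cong-≗ (λ v → *-distribˡ-sum (off v) (λ s → edge G v (c s))) ⟩
      ∑[ v < n ] ∑[ s < K ] (off v * edge G v (c s))  ≡⟨ ∑-comm (λ v s → off v * edge G v (c s)) ⟩
      ∑[ s < K ] ∑[ v < n ] (off v * edge G v (c s))  ≡⟨ sum-cong-≗ (λ s → sum-cong-≗ (λ v → cong (off v *_) (edge-sym G v (c s)))) ⟩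
      crossSum                                        ∎
    off-cycle : ∑[ v < n ] (off v * deg G v) ≡ crossSum + offSum
    off-cycle = begin
      ∑[ v < n ] (off v * deg G v)
        ≡⟨ sum-cong-≗ (λ v → trans (cong (off v *_) (deg-split v)) (*-distribˡ-+ (off v) _ (outdeg v))) ⟩
      ∑[ v < n ] (off v * ∑[ s < K ] edge G v (c s) + off v * outdeg v)
        ≡⟨ ∑-distrib-+ (λ v → off v * ∑[ s < K ] edge G v (c s)) (λ v → off v * outdeg v) ⟩
      ∑[ v < n ] (off v * ∑[ s < K ] edge G v (c s)) + offSum
        ≡⟨ cong (_+ offSum) edges-to-cycle ⟩
      crossSum + offSum ∎

  induced : Graph K
  induced = record
    { adj = λ t s → adj G (c t) (c s)
    ; sym = λ t s → adj-sym G (c t) (c s)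
    ; irrefl = λ t → adj-irrefl G (c t) }

  innerSum≡2e : innerSum ≡ e induced + e induced
  innerSum≡2e = sym (handshake induced)

  1+row≤K : ∀ t → suc (row t) ≤ K
  1+row≤K t = subst (suc (row t) ≤_) (sum-1 K)
    (sum-<-pointwise (λ s → 𝟙≤1 (adj G (c t) (c s))) t (subst (_< 1) (sym (edge-irrefl G (c t))) (s≤s z≤n)))

  innerSum+K≤K*K : innerSum + K ≤ K * K
  innerSum+K≤K*K = begin
    innerSum + K               ≡⟨ cong (innerSum +_) (sum-1 K) ⟨
    innerSum + ∑[ t < K ] 1    ≡⟨ ∑-distrib-+ row (λ _ → 1) ⟨
    ∑[ t < K ] (row t + 1)     ≤⟨ sum-mono-≤ (λ t → subst (_≤ K) (+-comm 1 (row t)) (1+row≤K t)) ⟩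
    ∑[ t < K ] K               ≡⟨ sum-const K K ⟩
    K * K                      ∎
    where open ≤-Reasoning

  off-weighted>off : ∀ {v m} → ¬ off v * m ≤ off v → Off G γ v × 1 < m
  off-weighted>off {v} {m} ≰ with off-cases v
  ... | inj₁ off≡0 = ⊥-elim (≰ (subst (λ o → o * m ≤ o) (sym off≡0) z≤n))
  ... | inj₂ off≡1 = off≡1⇒Off off≡1 ,
          ≰⇒> (λ m≤1 → ≰ (subst (λ o → o * m ≤ o) (sym off≡1) (subst (_≤ 1) (sym (+-identityʳ m)) m≤1)))

  innerSum≤2·KC2 : innerSum ≤ K C 2 + K C 2
  innerSum≤2·KC2 = +-cancelʳ-≤ K _ _ (subst (innerSum + K ≤_) (sym (choose-2-double K)) innerSum+K≤K*K)

  n∸K≡offCount : n ∸ K ≡ offCount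
  n∸K≡offCount = trans (cong (_∸ K) n≡K+offCount) (m+n∸m≡n K offCount)

  OnCycle : Fin n → Set
  OnCycle = Inside K (vertex γ)

  OffMaxDeg≤1 : Set
  OffMaxDeg≤1 = ∀ v → off v * outdeg v ≤ off v

  off-max-deg? : OffMaxDeg≤1 ⊎ Σ (Fin n) λ v → Off G γ v × 1 < outdeg v
  off-max-deg? with all-or-counterexample (λ v → off v * outdeg v ≤? off v)
  ... | inj₁ off-max≤1 = inj₁ off-max≤1
  ... | inj₂ (v , ≰)   = inj₂ (v , off-weighted>off ≰)

  ¬OnCycle⇒off≡1 : ∀ {v} → ¬ OnCycle v → off v ≡ 1
  ¬OnCycle⇒off≡1 {v} v-out with off-cases v
  ... | inj₂ off≡1 = off≡1
  ... | inj₁ off≡0 with off≡0⇒on off≡0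
  ...   | t , cₜ≡v = ⊥-elim (v-out (toℕ t , toℕ<n t , cₜ≡v))

  full-row⇒adjacent : ∀ t → suc (row t) ≡ K → ∀ s → ¬ t ≡ s → Edge G (c t) (c s)
  full-row⇒adjacent t full s t≢s with adj G (c t) (c s) in eq
  ... | true  = refl
  ... | false = ⊥-elim (<⇒≱ (subst (suc (row t) <_) (sum-1 K) (sum-<-pointwise₂ (λ _ → 𝟙≤1 _) t≢s self-loop missing))
                             (≤-reflexive (sym full)))
    where
    self-loop : edge G (c t) (c t) < 1
    self-loop = subst (_< 1) (sym (edge-irrefl G (c t))) (s≤s z≤n)
    missing : edge G (c t) (c s) < 1
    missing = subst (_< 1) (sym (cong 𝟙 eq)) (s≤s z≤n)

  maximal-innerSum⇒clique : innerSum + K ≡ K * K →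
    ∀ {t s} → t < K → s < K → ¬ t ≡ s → Edge G (vertex γ t) (vertex γ s)
  maximal-innerSum⇒clique maximal {t} {s} t<K s<K t≢s =
    subst₂ (λ a b → Edge G (vertex γ a) (vertex γ b)) (toℕ-fromℕ< t<K) (toℕ-fromℕ< s<K)
      (full-row⇒adjacent (fromℕ< t<K) (full-rows _) (fromℕ< s<K)
        (λ e → t≢s (trans (sym (toℕ-fromℕ< t<K)) (trans (cong toℕ e) (toℕ-fromℕ< s<K)))))
    where
    full-rows : ∀ t → suc (row t) ≡ K
    full-rows = sum-≤-pointwise-≡ 1+row≤K (≤-reflexive (begin
      ∑[ t < K ] K             ≡⟨ sum-const K K ⟩
      K * K                    ≡⟨ maximal ⟨
      innerSum + K             ≡⟨ +-comm innerSum K ⟩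
      K + innerSum             ≡⟨ cong (_+ innerSum) (sum-1 K) ⟨
      ∑[ t < K ] 1 + innerSum  ≡⟨ ∑-distrib-+ (λ _ → 1) row ⟨
      ∑[ t < K ] suc (row t)   ∎))
      where open ≡-Reasoning

  no-crossing⇒no-edge-leaving : crossSum ≡ 0 → ∀ {t x} → t < K → ¬ OnCycle x → ¬ Edge G (vertex γ t) x
  no-crossing⇒no-edge-leaving cross≡0 {t} {x} t<K x-out γₜ~x = 0≢1+n (begin
    0                               ≡⟨ sum≡0⇒≡0 (λ j → off j * edge G (vertex γ t) j) outdeg≡0 x ⟨
    off x * edge G (vertex γ t) x   ≡⟨ cong₂ _*_ (¬OnCycle⇒off≡1 x-out) (cong 𝟙 γₜ~x) ⟩
    1                               ∎)
    where
    open ≡-Reasoning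
    outdeg≡0 : outdeg (vertex γ t) ≡ 0
    outdeg≡0 = Fin-∀⇒<-∀ (λ i → outdeg (vertex γ i) ≡ 0) (sum≡0⇒≡0 (outdeg ∘ c) cross≡0) t t<K

  no-crossing⇒outside-deg≤1 : crossSum ≡ 0 → OffMaxDeg≤1 →
    ∀ {v x y} → ¬ OnCycle v → Edge G v x → Edge G v y → x ≡ y
  no-crossing⇒outside-deg≤1 cross≡0 off-max≤1 {v} {x} {y} v-out v~x v~y with x ≟ᶠ y
  ... | yes x≡y = x≡y
  ... | no x≢y  = ⊥-elim (≤⇒≯ (≤-trans 2≤outdeg outdeg≤1) ≤-refl)
    where
    counted : ∀ {w} → Edge G v w → 0 < off w * edge G v w
    counted {w} v~w = subst (0 <_) (sym (cong₂ _*_ (¬OnCycle⇒off≡1 w-out) (cong 𝟙 v~w))) (s≤s z≤n)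
      where
      w-out : ¬ OnCycle w
      w-out (t , t<K , γₜ≡w) = no-crossing⇒no-edge-leaving cross≡0 t<K v-out
                                 (subst (λ u → Edge G u v) (sym γₜ≡w) (Edge-sym G v~w))
    2≤outdeg : 2 ≤ outdeg v
    2≤outdeg = subst (λ z → 2 + z ≤ outdeg v) (sum-0 n) (sum-<-pointwise₂ (λ _ → z≤n) x≢y (counted v~x) (counted v~y))
    outdeg≤1 : outdeg v ≤ 1
    outdeg≤1 = subst (_≤ 1) (+-identityʳ (outdeg v)) (subst (λ o → o * outdeg v ≤ o) (¬OnCycle⇒off≡1 v-out) (off-max≤1 v))

  at-most-one-isolated : OffMaxDeg≤1 → offCount ≤ suc offSum →
    ∀ {v w} → ¬ OnCycle v → ¬ OnCycle w → (∀ x → ¬ Edge G v x) → (∀ x → ¬ Edge G w x) → v ≡ w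
  at-most-one-isolated off-max≤1 offCount≤ {v} {w} v-out w-out v-isolated w-isolated with v ≟ᶠ w
  ... | yes v≡w = v≡w
  ... | no v≢w  = ⊥-elim (<⇒≱ (sum-<-pointwise₂ off-max≤1 v≢w (uncounted v-out v-isolated) (uncounted w-out w-isolated))
                           offCount≤)
    where
    uncounted : ∀ {u} → ¬ OnCycle u → (∀ x → ¬ Edge G u x) → off u * outdeg u < off u
    uncounted {u} u-out u-isolated = subst₂ _<_
      (sym (trans (cong (off u *_) outdeg≡0) (*-zeroʳ (off u)))) (sym (¬OnCycle⇒off≡1 u-out)) (s≤s z≤n)
      where
      outdeg≡0 : outdeg u ≡ 0
      outdeg≡0 = trans (sum-cong-≗ (λ j → trans (cong (off j *_) (¬Edge⇒edge≡0 G (u-isolated j))) (*-zeroʳ (off j))))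
                   (sum-0 n)

  sparse-cycle⇒K∪M : crossSum ≡ 0 → OffMaxDeg≤1 → K C 2 + (n ∸ K) / 2 ≤ e G → Iso G (KMRel K n)
  sparse-cycle⇒K∪M cross≡0 off-max≤1 lower =
    K∪M-recognition.isomorphic G K (vertex γ) K≤n (distinct γ)
      (maximal-innerSum⇒clique maximal) (no-crossing⇒no-edge-leaving cross≡0)
      (no-crossing⇒outside-deg≤1 cross≡0 off-max≤1) (at-most-one-isolated off-max≤1 (proj₂ counts))
    where
    K≤n : K ≤ n
    K≤n = subst (K ≤_) (sym n≡K+offCount) (m≤m+n K offCount)
    2e≡inner+off : e G + e G ≡ innerSum + offSum
    2e≡inner+off = trans decomposition
      (trans (cong (λ x → innerSum + (x + x) + offSum) cross≡0) (cong (_+ offSum) (+-identityʳ innerSum)))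
    counts : e induced ≡ K C 2 × offCount ≤ suc offSum
    counts = odd-cycle-arithmetic {h = e induced} 2e≡inner+off innerSum≡2e innerSum≤2·KC2 (sum-mono-≤ off-max≤1)
               (subst (λ u → K C 2 + u / 2 ≤ e G) n∸K≡offCount lower)
    maximal : innerSum + K ≡ K * K
    maximal = trans (cong (λ h → h + K) (trans innerSum≡2e (cong (λ h → h + h) (proj₁ counts)))) (choose-2-double K)

  off-vertex-outdeg>1 : ∀ {m} → m ≤ suc k → ∀ {v} → Off G γ v → 1 < outdeg v → Path∪P₃ G m
  off-vertex-outdeg>1 m≤K v∉γ >1 with outdeg>1⇒two-neighbours >1
  ... | x , y , x≢y , (x∉γ , v~x) , (y∉γ , v~y) =
    prefix∪cherry γ m≤K x∉γ y∉γ x≢y (Edge-sym G v~x) v~y (prefix-avoids-Off γ m≤K v∉γ)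

  cycle-vertex-outdeg>1 : ∀ t → 1 < outdeg (vertex γ t) → Path∪P₃ G k
  cycle-vertex-outdeg>1 t >1 with outdeg>1⇒two-neighbours >1
  ... | x , y , x≢y , (x∉γ , γₜ~x) , (y∉γ , γₜ~y) =
    prefix∪cherry γ′ (n≤1+n k) (rotate-Off G (suc t) γ x∉γ) (rotate-Off G (suc t) γ y∉γ) x≢y
      (Edge-sym G (subst (λ w → Edge G w x) (sym γ′ₖ≡γₜ) γₜ~x))
      (subst (λ w → Edge G w y) (sym γ′ₖ≡γₜ) γₜ~y)
      (prefix-avoids-later γ′ (n≤1+n k) ≤-refl ≤-refl)
    where
    γ′ = rotate G (suc t) γ
    γ′ₖ≡γₜ = rotate-last G t γ

-- The even and the odd cycle

module _ {n} {G : Graph n} {q} (γ : Cycle G (suc (suc q))) where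
  open AroundCycle γ

  consecutive-outdeg-pos : ∀ t → 0 < outdeg (vertex γ t) × 0 < outdeg (vertex γ (suc t)) →
    (Contains G (CycleRel (suc (suc (suc q)))) → Path∪P₃ G (suc q)) → Path∪P₃ G (suc q)
  consecutive-outdeg-pos t (pos₀ , pos₁) longer-cycle
    with outdeg-pos⇒neighbour pos₀ | outdeg-pos⇒neighbour pos₁
  ... | x , x∉γ , γₜ~x | y , y∉γ , γₜ₊₁~y with x ≟ᶠ y
  ...   | yes refl = longer-cycle (insert-common-neighbour G γ′ x∉γ′ (Edge-sym G γ′₀~x) γ′ₗₐₛₜ~x)
    where
    γ′ = rotate G (suc t) γ
    x∉γ′ = rotate-Off G (suc t) γ x∉γ
    γ′₀~x = subst (λ w → Edge G w x) (sym (rotate-vertex G (suc t) γ 0)) γₜ₊₁~y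
    γ′ₗₐₛₜ~x = subst (λ w → Edge G w x) (sym (rotate-last G t γ)) γₜ~x
  ...   | no x≢y = pendant∪prefix γ′ ≤-refl y∉γ′ (Edge-sym G γ′₀~y) (λ _ → x∉γ′ _) x≢y γ′ₗₐₛₜ~x
    where
    γ′ = rotate G (suc t) γ
    x∉γ′ = rotate-Off G (suc t) γ x∉γ
    y∉γ′ = rotate-Off G (suc t) γ y∉γ
    γ′₀~y = subst (λ w → Edge G w y) (sym (rotate-vertex G (suc t) γ 0)) γₜ₊₁~y
    γ′ₗₐₛₜ~x = subst (λ w → Edge G w x) (sym (rotate-last G t γ)) γₜ~x

module _ {n} {G : Graph n} (l : ℕ) (γ : Cycle G (double (suc l))) where
  open AroundCycle γ

  sparse-even-cycle-impossible : 1 ≤ l → suc K C 2 + (n ∸ suc K) / 2 ≤ e G →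
    OffMaxDeg≤1 →
    (∀ j → suc j < K → outdeg (vertex γ j) + outdeg (vertex γ (suc j)) ≤ 1) → ⊥
  sparse-even-cycle-impossible 1≤l lower off-max≤1 pairs = <⇒≱ 1≤l l≤0
    where
    lower′ : K + K C 2 + (offCount ∸ 1) / 2 ≤ e G
    lower′ = subst₂ (λ a b → a + b / 2 ≤ e G) (suc-choose-2 K)
               (trans (cong (n ∸_) (+-comm 1 K)) (trans (sym (∸-+-assoc n K 1)) (cong (_∸ 1) n∸K≡offCount))) lower
    K≤l+2 : K ≤ l + 2
    K≤l+2 = even-cycle-arithmetic decomposition (innerSum≤2·KC2)
              (sum-consecutive-pairs≤ (suc l) (λ j → outdeg (vertex γ j)) pairs) (sum-mono-≤ off-max≤1) lower′
    l≤0 : l ≤ 0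
    l≤0 = +-cancelˡ-≤ l _ _ (subst (_≤ l + 0) (double≡m+m l)
            (≤-pred (≤-pred (subst (K ≤_) (trans (+-comm l 2) (cong (2 +_) (sym (+-identityʳ l)))) K≤l+2))))

  even-cycle⇒Path∪P₃ : 1 ≤ l → suc K C 2 + (n ∸ suc K) / 2 ≤ e G →
    (Contains G (CycleRel (suc K)) → Path∪P₃ G (suc (double l))) → Path∪P₃ G (suc (double l))
  even-cycle⇒Path∪P₃ 1≤l lower longer-cycle
    with off-max-deg?
  ... | inj₂ (v , v∉γ , >1) = off-vertex-outdeg>1 (n≤1+n _) v∉γ >1
  ... | inj₁ off-max≤1 with all-or-counterexample (λ t → outdeg (c t) ≤? 1)
  ...   | inj₂ (t , ≰) = cycle-vertex-outdeg>1 (toℕ t) (≰⇒> ≰)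
  ...   | inj₁ cycle-max≤1 with all-or-counterexample
            (λ (t : Fin (suc (double l))) → outdeg (vertex γ (toℕ t)) + outdeg (vertex γ (suc (toℕ t))) ≤? 1)
  ...     | inj₂ (t , ≰) = consecutive-outdeg-pos γ (toℕ t)
                             (m+n≰1⇒both-pos (max≤1 (toℕ t) (<-trans (toℕ<n t) (n<1+n _))) (max≤1 (suc (toℕ t)) (s≤s (toℕ<n t))) ≰)
                             longer-cycle
    where max≤1 = Fin-∀⇒<-∀ (λ j → outdeg (vertex γ j) ≤ 1) cycle-max≤1
  ...     | inj₁ pairs = ⊥-elim (sparse-even-cycle-impossible 1≤l lower off-max≤1
                           (λ j j+1<K → Fin-∀⇒<-∀ (λ i → outdeg (vertex γ i) + outdeg (vertex γ (suc i)) ≤ 1) pairs j (≤-pred j+1<K)))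

module _ {n} {G : Graph n} {q} (γ : Cycle G (suc (suc (suc q)))) where
  open AroundCycle γ

  cycle-vertex-outdeg-pos : ∀ t → 0 < outdeg (vertex γ t) → Path∪P₃ G (suc q)
  cycle-vertex-outdeg-pos t pos with outdeg-pos⇒neighbour pos
  ... | x , x∉γ , γₜ~x = pendant∪prefix γ′ (n≤1+n _) x∉γ′ (subst (Edge G x) (sym (rotate-vertex G t γ 0)) (Edge-sym G γₜ~x))
                           (prefix-avoids-later γ′ (n≤1+n _) ≤-refl ≤-refl) (x∉γ′ _) (step γ′ (suc q))
    where
    γ′ = rotate G t γ
    x∉γ′ = rotate-Off G t γ x∉γ

  odd-cycle⇒Path∪P₃ : ¬ Iso G (KMRel K n) → K C 2 + (n ∸ K) / 2 ≤ e G → Path∪P₃ G (suc q)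
  odd-cycle⇒Path∪P₃ ¬iso lower with crossSum ≟ 0
  ... | no cross≢0 with sum-pos⇒∃ (outdeg ∘ c) (n≢0⇒n>0 cross≢0)
  ...   | t , pos = cycle-vertex-outdeg-pos (toℕ t) pos
  odd-cycle⇒Path∪P₃ ¬iso lower | yes cross≡0 with off-max-deg?
  ...   | inj₂ (v , v∉γ , >1) = off-vertex-outdeg>1 (≤-trans (n≤1+n _) (n≤1+n _)) v∉γ >1
  ...   | inj₁ off-max≤1     = ⊥-elim (¬iso (sparse-cycle⇒K∪M cross≡0 off-max≤1 lower))

2*l+r≡r+double-l : ∀ l r → 2 * l + r ≡ r + double l
2*l+r≡r+double-l l r = trans (+-comm (2 * l) r) (cong (r +_) (trans (cong (l +_) (+-identityʳ l)) (sym (double≡m+m l))))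

lemma4p2 : (l n : ℕ) → 1 ≤ l → 1 ≤ n → (G : Graph n)
         → ¬ Iso G (KMRel (2 * l + 3) n)
         → ((2 * l + 3) C 2) + (n ∸ (2 * l + 3)) / 2 ≤ e G
         → Contains G (CycleRel (2 * l + 2)) ⊎ Contains G (CycleRel (2 * l + 3))
         → Contains G (DisjUnion {2 * l + 1} {3} (PathRel (2 * l + 1)) (PathRel 3))
lemma4p2 l n 1≤l _ G ¬iso lower cycle =
  subst (Path∪P₃ G) (sym (2*l+r≡r+double-l l 1)) ([ even ∘ resize 2 , odd ∘ resize 3 ] cycle)
  where
  resize : ∀ r → Contains G (CycleRel (2 * l + r)) → Contains G (CycleRel (r + double l))
  resize r = subst (Contains G ∘ CycleRel) (2*l+r≡r+double-l l r)
  lower′ : (3 + double l) C 2 + (n ∸ (3 + double l)) / 2 ≤ e G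
  lower′ = subst (λ K → K C 2 + (n ∸ K) / 2 ≤ e G) (2*l+r≡r+double-l l 3) lower
  odd : Contains G (CycleRel (3 + double l)) → Path∪P₃ G (suc (double l))
  odd C₃ = odd-cycle⇒Path∪P₃ (Contains-cycle⇒Cycle G C₃)
             (subst (λ K → ¬ Iso G (KMRel K n)) (2*l+r≡r+double-l l 3) ¬iso) lower′
  even : Contains G (CycleRel (2 + double l)) → Path∪P₃ G (suc (double l))
  even C₂ = even-cycle⇒Path∪P₃ l (Contains-cycle⇒Cycle G C₂) 1≤l lower′ odd
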